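{- The operators $\widetilde u_i,\widetilde d_i$ ($i\ge1$) satisfy: (non-local) $[\widetilde u_i,\widetilde u_j]=[\widetilde d_i,\widetilde d_j]=0$ for $|i-j|\ge2$; (local) $[\widetilde u_{i+1}\widetilde u_i,\ \widetilde u_i+\widetilde u_{i+1}]=[\widetilde d_i\widetilde d_{i+1},\ \widetilde d_i+\widetilde d_{i+1}]=0$ for $i\ge1$; (conjugate) $[\widetilde u_i,\widetilde d_j]=0$ for $|i-j|\ge2$, $[\widetilde u_{i+1},\widetilde d_i]=0$ for $i\ge1$, and $\widetilde d_1\widetilde u_1=1$.
   Context: $\beta$ is a scalar and $\mathbb{Z}[\beta]P$ the free $\mathbb{Z}[\beta]$-module with basis all partitions (Young diagrams, columns indexed $1,2,\dots$ from the left). For $i\ge1$, the Schur operator $u_i$ maps $\lambda$ to the partition obtained by adding a box in column $i$ if this is a partition and to $0$ otherwise; $d_i$ similarly removes a box from column $i$. $\widetilde u_i:=u_i(1-\beta d_i)=u_i-\beta u_id_i$, $\widetilde d_i:=(1-\beta d_i)^{ -1}d_i=d_i+\beta d_i^2+\beta^2d_i^3+\cdots$. $[a,b]=ab-ba$. -}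

module Defs where

open import Level using (Level)
open import Data.Nat as ℕ using (ℕ; zero; suc; _≥_; _≥?_; _<?_; _∸_)
open import Data.List using (List; []; _∷_; _++_; map; concatMap; foldr; upTo)
open import Data.Nat.ListAction using (sum)
open import Data.List.Relation.Unary.Linked using (Linked; linked?)
open import Data.List.Relation.Unary.All using (All; all?)
open import Data.List.Properties using () renaming (≡-dec to list-≡-dec)
open import Data.Maybe using (Maybe; just; nothing)
open import Data.Product using (_×_; _,_)
open import Relation.Nullary using (yes; no)
open import Relation.Binary.PropositionalEquality using (_≡_)
open import Algebra.Bundles using (CommutativeRing)

-- Partitions (Young diagrams), encoded by their COLUMN heights
-- (column 1 first): a weakly decreasing list of positive naturals.

record Partition : Set where
  constructor mkPartition
  field
    cols  : List ℕ
    decr  : Linked _≥_ cols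
    pos   : All (ℕ._<_ 0) cols

open Partition public

size : Partition → ℕ
size λ′ = sum (cols λ′)

stripZ : List ℕ → List ℕ
stripZ [] = []
stripZ (h ∷ hs) with stripZ hs
... | [] with h
...   | zero  = []
...   | suc k = suc k ∷ []
stripZ (h ∷ hs) | r ∷ rs = h ∷ r ∷ rs

toPartition : List ℕ → Maybe Partition
toPartition xs with stripZ xs
... | ys with linked? _≥?_ ys | all? (0 <?_) ys
...   | yes d | yes p = just (mkPartition ys d p)
...   | _     | _     = nothing

rawAdd : ℕ → List ℕ → List ℕ
rawAdd zero    []       = 1 ∷ []
rawAdd zero    (h ∷ hs) = suc h ∷ hs
rawAdd (suc k) []       = 0 ∷ rawAdd k []
rawAdd (suc k) (h ∷ hs) = h ∷ rawAdd k hs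

rawSub : ℕ → List ℕ → Maybe (List ℕ)
rawSub zero    []             = nothing
rawSub zero    (zero ∷ hs)    = nothing
rawSub zero    (suc h ∷ hs)   = just (h ∷ hs)
rawSub (suc k) []             = nothing
rawSub (suc k) (h ∷ hs) with rawSub k hs
... | nothing = nothing
... | just ys = just (h ∷ ys)

-- The free R-module on partitions and the operators, for a commutative
-- ring R and a scalar β ∈ R (R = ℤ[β] is the paper's case).

module Ops {c ℓ : Level} (R : CommutativeRing c ℓ) (β : CommutativeRing.Carrier R) where
  open CommutativeRing R

  -- finite formal R-linear combinations of partitions
  Mod : Set c
  Mod = List (Carrier × Partition)

  𝟘 : Mod
  𝟘 = []

  basis : Partition → Mod
  basis λ′ = (1# , λ′) ∷ []

  _⊕_ : Mod → Mod → Mod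
  _⊕_ = _++_

  scale : Carrier → Mod → Mod
  scale a = map (λ { (b , λ′) → (a * b , λ′) })

  _⊖_ : Mod → Mod → Mod
  v ⊖ w = v ⊕ scale (- 1#) w

  coeff : Partition → Mod → Carrier
  coeff μ [] = 0#
  coeff μ ((a , λ′) ∷ v) with list-≡-dec ℕ._≟_ (cols λ′) (cols μ)
  ... | yes _ = a + coeff μ v
  ... | no  _ = coeff μ v

  infix 4 _≃_
  _≃_ : Mod → Mod → Set ℓ
  v ≃ w = (μ : Partition) → coeff μ v ≈ coeff μ w

  Op : Set c
  Op = Mod → Mod

  linExt : (Partition → Mod) → Op
  linExt f = concatMap (λ { (a , λ′) → scale a (f λ′) })

  fromMaybe : Maybe Partition → Mod
  fromMaybe nothing   = 𝟘
  fromMaybe (just μ) = basis μ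

  -- Schur operators u_i, d_i for column i ≥ 1 (column i is 0-based position i ∸ 1)
  u : ℕ → Op
  u i = linExt (λ λ′ → fromMaybe (toPartition (rawAdd (i ∸ 1) (cols λ′))))

  d : ℕ → Op
  d i = linExt (λ λ′ → go (rawSub (i ∸ 1) (cols λ′)))
    where
    go : Maybe (List ℕ) → Mod
    go nothing   = 𝟘
    go (just xs) = fromMaybe (toPartition xs)

  _∘ₒ_ : Op → Op → Op
  (A ∘ₒ B) v = A (B v)

  _+ₒ_ : Op → Op → Op
  (A +ₒ B) v = A v ⊕ B v

  ⟦_,_⟧ : Op → Op → Op
  ⟦ A , B ⟧ v = A (B v) ⊖ B (A v)

  pow : Carrier → ℕ → Carrier
  pow a zero    = 1#
  pow a (suc n) = a * pow a n

  iter : ℕ → Op → Op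
  iter zero    A v = v
  iter (suc n) A v = A (iter n A v)

  -- ũ_i = u_i (1 - β d_i) = u_i - β u_i d_i
  ũ : ℕ → Op
  ũ i v = u i v ⊖ scale β (u i (d i v))

  -- d̃_i = (1 - β d_i)^{-1} d_i = Σ_{k ≥ 0} β^k d_i^{k+1}.
  -- On a basis vector λ the terms with k + 1 > |λ| vanish, so the series is
  -- the finite sum over k = 0 .. |λ|.
  d̃ : ℕ → Op
  d̃ i = linExt (λ λ′ → foldr (λ k acc → scale (pow β k) (iter (suc k) (d i) (basis λ′)) ⊕ acc)
                              𝟘 (upTo (suc (size λ′))))

-- Pairing the module with functions on column lists turns u, d, d̃, ũ into explicit transposed
-- operators U, D, D̃, Ũ (evaluate after adding or removing a box, when allowed), and a relation
-- among the operators follows from the transposed relation on partitions.  Since D lowers the number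
-- of boxes, D̃ is characterised by D̃ = D + β D D̃; hence any linear operator commuting with D_k
-- commutes with D̃_k.  This reduces the relations involving d̃ (and d̃₁ũ₁ = 1) to elementary ones for
-- d and ũ, which are direct computations with the guards.  The local ũ relation only involves three
-- consecutive column gaps and is verified symbolically over finitely many gap classes; the local d̃
-- relation, multiplied by (1 − β d_i)(1 − β d_{i+1}), is a formal consequence of the plactic
-- relations d_i d_{i+1} d_i = d_i d_i d_{i+1} and d_{i+1} d_i d_{i+1} = d_i d_{i+1} d_{i+1}.

module Submission where

open import Defs
open import Level using (Level)
open import Data.Nat using (ℕ; suc; _≤_; ∣_-_∣)
open import Data.Product using (_×_; _,_)
open import Algebra.Bundles using (CommutativeRing)

module ColumnLists where
  open import Data.Bool using (Bool; true; false; T; _∧_)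
  open import Data.Bool.Properties using (∧-zeroʳ)
  open import Data.Empty using (⊥-elim)
  open import Data.List using (List; []; _∷_)
  open import Data.List.Relation.Unary.All using (All; []; _∷_; all?)
  open import Data.List.Relation.Unary.Linked using (Linked; []; [-]; _∷_; linked?)
  open import Data.Maybe using (Maybe; just; nothing)
  open import Data.Nat as ℕ using (ℕ; zero; suc; pred; _+_; _∸_; _≤_; _<_; z≤n; s≤s; _<ᵇ_; _≟_; _≥?_; _<?_; ∣_-_∣)
  open import Data.Nat.ListAction using (sum)
  open import Data.Nat.Properties
    using (≤-trans; <-≤-trans; +-suc; 1+n≢n; m≤n⇒m≤1+n; n≤1+n; pred[n]≤n; <⇒≤pred; suc-injective;
           <ᵇ⇒<; <⇒<ᵇ; ∣n-n∣≡0; pred[m∸n]≡m∸[1+n]; +-∸-assoc)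
  open import Data.Product using (Σ; _×_; _,_; proj₁; proj₂)
  open import Data.Unit using (tt)
  open import Function using (_∘_)
  open import Relation.Nullary using (¬_; yes; no)
  open import Relation.Binary.PropositionalEquality
    using (_≡_; _≢_; refl; sym; trans; cong; cong₂; subst; subst₂)

  height : List ℕ → ℕ → ℕ
  height []       _       = 0
  height (x ∷ xs) zero    = x
  height (x ∷ xs) (suc n) = height xs n

  -- pred 0 = 0: on an empty column rawDec does nothing, so it is always guarded by removable.
  rawDec : ℕ → List ℕ → List ℕ
  rawDec k       []       = []
  rawDec zero    (h ∷ hs) = pred h ∷ hs
  rawDec (suc k) (h ∷ hs) = h ∷ rawDec k hs

  infix 4 _≋_
  _≋_ : List ℕ → List ℕ → Set
  xs ≋ ys = ∀ n → height xs n ≡ height ys n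

  Decreasing : List ℕ → Set
  Decreasing xs = ∀ n → height xs (suc n) ≤ height xs n

  n≢1+n : ∀ {n} → n ≢ suc n
  n≢1+n e = 1+n≢n (sym e)

  2+n≢n : ∀ {n} → suc (suc n) ≢ n
  2+n≢n {zero}  ()
  2+n≢n {suc n} e = 2+n≢n (suc-injective e)

  n≢2+n : ∀ {n} → n ≢ suc (suc n)
  n≢2+n e = 2+n≢n (sym e)

  height-rawAdd-≡ : ∀ k xs → height (rawAdd k xs) k ≡ suc (height xs k)
  height-rawAdd-≡ zero    []       = refl
  height-rawAdd-≡ zero    (h ∷ hs) = refl
  height-rawAdd-≡ (suc k) []       = height-rawAdd-≡ k []
  height-rawAdd-≡ (suc k) (h ∷ hs) = height-rawAdd-≡ k hs

  height-rawAdd-≢ : ∀ k xs n → n ≢ k → height (rawAdd k xs) n ≡ height xs n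
  height-rawAdd-≢ zero    []       zero    n≢k = ⊥-elim (n≢k refl)
  height-rawAdd-≢ zero    []       (suc n) n≢k = refl
  height-rawAdd-≢ zero    (h ∷ hs) zero    n≢k = ⊥-elim (n≢k refl)
  height-rawAdd-≢ zero    (h ∷ hs) (suc n) n≢k = refl
  height-rawAdd-≢ (suc k) []       zero    n≢k = refl
  height-rawAdd-≢ (suc k) []       (suc n) n≢k = height-rawAdd-≢ k [] n (n≢k ∘ cong suc)
  height-rawAdd-≢ (suc k) (h ∷ hs) zero    n≢k = refl
  height-rawAdd-≢ (suc k) (h ∷ hs) (suc n) n≢k = height-rawAdd-≢ k hs n (n≢k ∘ cong suc)

  height-rawDec-≡ : ∀ k xs → height (rawDec k xs) k ≡ pred (height xs k)
  height-rawDec-≡ zero    []       = refl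
  height-rawDec-≡ zero    (h ∷ hs) = refl
  height-rawDec-≡ (suc k) []       = refl
  height-rawDec-≡ (suc k) (h ∷ hs) = height-rawDec-≡ k hs

  height-rawDec-≢ : ∀ k xs n → n ≢ k → height (rawDec k xs) n ≡ height xs n
  height-rawDec-≢ k       []       n       n≢k = refl
  height-rawDec-≢ zero    (h ∷ hs) zero    n≢k = ⊥-elim (n≢k refl)
  height-rawDec-≢ zero    (h ∷ hs) (suc n) n≢k = refl
  height-rawDec-≢ (suc k) (h ∷ hs) zero    n≢k = refl
  height-rawDec-≢ (suc k) (h ∷ hs) (suc n) n≢k = height-rawDec-≢ k hs n (n≢k ∘ cong suc)

  rawSub-empty : ∀ k xs → height xs k ≡ 0 → rawSub k xs ≡ nothing
  rawSub-empty zero    []          e = refl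
  rawSub-empty zero    (zero ∷ hs) e = refl
  rawSub-empty (suc k) []          e = refl
  rawSub-empty (suc k) (h ∷ hs)    e rewrite rawSub-empty k hs e = refl

  rawSub-nonempty : ∀ k xs → 0 < height xs k → rawSub k xs ≡ just (rawDec k xs)
  rawSub-nonempty zero    (suc h ∷ hs) p = refl
  rawSub-nonempty (suc k) (h ∷ hs)     p rewrite rawSub-nonempty k hs p = refl

  rawAdd-comm : ∀ i j xs → rawAdd i (rawAdd j xs) ≡ rawAdd j (rawAdd i xs)
  rawAdd-comm zero    zero    xs       = refl
  rawAdd-comm zero    (suc j) []       = refl
  rawAdd-comm zero    (suc j) (h ∷ hs) = refl
  rawAdd-comm (suc i) zero    []       = refl
  rawAdd-comm (suc i) zero    (h ∷ hs) = refl
  rawAdd-comm (suc i) (suc j) []       = cong (0 ∷_) (rawAdd-comm i j [])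
  rawAdd-comm (suc i) (suc j) (h ∷ hs) = cong (h ∷_) (rawAdd-comm i j hs)

  rawDec-comm : ∀ i j xs → rawDec i (rawDec j xs) ≡ rawDec j (rawDec i xs)
  rawDec-comm i       j       []       = refl
  rawDec-comm zero    zero    (h ∷ hs) = refl
  rawDec-comm zero    (suc j) (h ∷ hs) = refl
  rawDec-comm (suc i) zero    (h ∷ hs) = refl
  rawDec-comm (suc i) (suc j) (h ∷ hs) = cong (h ∷_) (rawDec-comm i j hs)

  rawAdd-rawDec-comm : ∀ i j xs → i ≢ j → rawAdd i (rawDec j xs) ≡ rawDec j (rawAdd i xs)
  rawAdd-rawDec-comm zero    zero    xs       i≢j = ⊥-elim (i≢j refl)
  rawAdd-rawDec-comm zero    (suc j) []       i≢j = refl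
  rawAdd-rawDec-comm zero    (suc j) (h ∷ hs) i≢j = refl
  rawAdd-rawDec-comm (suc i) zero    []       i≢j = refl
  rawAdd-rawDec-comm (suc i) zero    (h ∷ hs) i≢j = refl
  rawAdd-rawDec-comm (suc i) (suc j) []       i≢j = cong (0 ∷_) (rawAdd-rawDec-comm i j [] (i≢j ∘ cong suc))
  rawAdd-rawDec-comm (suc i) (suc j) (h ∷ hs) i≢j = cong (h ∷_) (rawAdd-rawDec-comm i j hs (i≢j ∘ cong suc))

  rawAdd-rawDec : ∀ k xs → 0 < height xs k → rawAdd k (rawDec k xs) ≡ xs
  rawAdd-rawDec zero    (suc h ∷ hs) p = refl
  rawAdd-rawDec (suc k) (h ∷ hs)     p = cong (h ∷_) (rawAdd-rawDec k hs p)

  rawAdd-resp-≋ : ∀ k {xs ys} → xs ≋ ys → rawAdd k xs ≋ rawAdd k ys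
  rawAdd-resp-≋ k {xs} {ys} e n with n ≟ k
  ... | yes refl = trans (height-rawAdd-≡ k xs) (trans (cong suc (e k)) (sym (height-rawAdd-≡ k ys)))
  ... | no n≢k   = trans (height-rawAdd-≢ k xs n n≢k) (trans (e n) (sym (height-rawAdd-≢ k ys n n≢k)))

  rawDec-resp-≋ : ∀ k {xs ys} → xs ≋ ys → rawDec k xs ≋ rawDec k ys
  rawDec-resp-≋ k {xs} {ys} e n with n ≟ k
  ... | yes refl = trans (height-rawDec-≡ k xs) (trans (cong pred (e k)) (sym (height-rawDec-≡ k ys)))
  ... | no n≢k   = trans (height-rawDec-≢ k xs n n≢k) (trans (e n) (sym (height-rawDec-≢ k ys n n≢k)))

  rawDec-rawAdd : ∀ k xs → rawDec k (rawAdd k xs) ≋ xs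
  rawDec-rawAdd k xs n with n ≟ k
  ... | yes refl = trans (height-rawDec-≡ k (rawAdd k xs)) (cong pred (height-rawAdd-≡ k xs))
  ... | no n≢k   = trans (height-rawDec-≢ k (rawAdd k xs) n n≢k) (height-rawAdd-≢ k xs n n≢k)

  sum-rawDec : ∀ k xs → 0 < height xs k → suc (sum (rawDec k xs)) ≡ sum xs
  sum-rawDec zero    (suc h ∷ hs) p = refl
  sum-rawDec (suc k) (h ∷ hs)     p = trans (sym (+-suc h _)) (cong (h +_) (sum-rawDec k hs p))

  sum-zeros : ∀ zs → (∀ n → height zs n ≡ 0) → sum zs ≡ 0
  sum-zeros []       z = refl
  sum-zeros (h ∷ hs) z rewrite z 0 = sum-zeros hs (z ∘ suc)

  sum-resp-≋ : ∀ xs ys → xs ≋ ys → sum xs ≡ sum ys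
  sum-resp-≋ []       ys       e = sym (sum-zeros ys (sym ∘ e))
  sum-resp-≋ (x ∷ xs) []       e = sum-zeros (x ∷ xs) e
  sum-resp-≋ (x ∷ xs) (y ∷ ys) e = cong₂ _+_ (e 0) (sum-resp-≋ xs ys (e ∘ suc))

  stripCons : ℕ → List ℕ → List ℕ
  stripCons h       (r ∷ rs) = h ∷ r ∷ rs
  stripCons zero    []       = []
  stripCons (suc h) []       = suc h ∷ []

  stripZ-∷ : ∀ h hs → stripZ (h ∷ hs) ≡ stripCons h (stripZ hs)
  stripZ-∷ h hs with stripZ hs
  ... | [] with h
  ...   | zero  = refl
  ...   | suc k = refl
  stripZ-∷ h hs | r ∷ rs = refl

  height-stripCons : ∀ h ys n → height (stripCons h ys) n ≡ height (h ∷ ys) n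
  height-stripCons h       (r ∷ rs) n       = refl
  height-stripCons zero    []       zero    = refl
  height-stripCons zero    []       (suc n) = refl
  height-stripCons (suc h) []       n       = refl

  height-stripZ : ∀ xs n → height (stripZ xs) n ≡ height xs n
  height-stripZ []       n = refl
  height-stripZ (h ∷ hs) n rewrite stripZ-∷ h hs = trans (height-stripCons h (stripZ hs) n) (tail n)
    where
    tail : ∀ n → height (h ∷ stripZ hs) n ≡ height (h ∷ hs) n
    tail zero    = refl
    tail (suc n) = height-stripZ hs n

  stripZ-zeros : ∀ zs → (∀ n → height zs n ≡ 0) → stripZ zs ≡ []
  stripZ-zeros []       z = refl
  stripZ-zeros (h ∷ hs) z rewrite stripZ-∷ h hs | stripZ-zeros hs (z ∘ suc) | z 0 = refl

  stripZ-resp-≋ : ∀ xs ys → xs ≋ ys → stripZ xs ≡ stripZ ys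
  stripZ-resp-≋ []       ys       e = sym (stripZ-zeros ys (sym ∘ e))
  stripZ-resp-≋ (x ∷ xs) []       e = stripZ-zeros (x ∷ xs) e
  stripZ-resp-≋ (x ∷ xs) (y ∷ ys) e
    rewrite stripZ-∷ x xs | stripZ-∷ y ys | e 0 | stripZ-resp-≋ xs ys (e ∘ suc) = refl

  stripZ-positive : ∀ xs → All (0 <_) xs → stripZ xs ≡ xs
  stripZ-positive []           []       = refl
  stripZ-positive (suc h ∷ hs) (p ∷ ps) rewrite stripZ-∷ (suc h) hs | stripZ-positive hs ps with hs
  ... | []     = refl
  ... | r ∷ rs = refl

  linked⇒decreasing : ∀ {xs} → Linked ℕ._≥_ xs → Decreasing xs
  linked⇒decreasing []      n       = z≤n
  linked⇒decreasing [-]     n       = z≤n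
  linked⇒decreasing (p ∷ l) zero    = p
  linked⇒decreasing (p ∷ l) (suc n) = linked⇒decreasing l n

  decreasing⇒linked : ∀ xs → Decreasing xs → Linked ℕ._≥_ xs
  decreasing⇒linked []           d = []
  decreasing⇒linked (x ∷ [])     d = [-]
  decreasing⇒linked (x ∷ y ∷ xs) d = d 0 ∷ decreasing⇒linked (y ∷ xs) (d ∘ suc)

  decreasing-resp-≋ : ∀ {xs ys} → xs ≋ ys → Decreasing xs → Decreasing ys
  decreasing-resp-≋ e d n = subst₂ _≤_ (e (suc n)) (e n) (d n)

  decreasing⇒stripZ-positive : ∀ xs → Decreasing xs → All (0 <_) (stripZ xs)
  decreasing⇒stripZ-positive []       d = []
  decreasing⇒stripZ-positive (h ∷ hs) d rewrite stripZ-∷ h hs =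
    cons h (stripZ hs) (decreasing⇒stripZ-positive hs (d ∘ suc)) (subst (_≤ h) (sym (height-stripZ hs 0)) (d 0))
    where
    cons : ∀ h ys → All (0 <_) ys → height ys 0 ≤ h → All (0 <_) (stripCons h ys)
    cons h       (r ∷ rs) (pr ∷ prs) le = <-≤-trans pr le ∷ pr ∷ prs
    cons zero    []       _          _  = []
    cons (suc k) []       _          _  = s≤s z≤n ∷ []

  toPartition-decreasing : ∀ xs → Decreasing xs → Σ Partition (λ μ → toPartition xs ≡ just μ × cols μ ≡ stripZ xs)
  toPartition-decreasing xs d
    with stripZ xs
       | decreasing⇒linked (stripZ xs) (decreasing-resp-≋ {xs} {stripZ xs} (sym ∘ height-stripZ xs) d)
       | decreasing⇒stripZ-positive xs d
  ... | ys | l | p with linked? ℕ._≥?_ ys | all? (0 <?_) ys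
  ...   | yes l′ | yes p′ = mkPartition ys l′ p′ , refl , refl
  ...   | no ¬l  | _      = ⊥-elim (¬l l)
  ...   | yes _  | no ¬p  = ⊥-elim (¬p p)

  toPartition-¬decreasing : ∀ xs → ¬ Decreasing xs → toPartition xs ≡ nothing
  toPartition-¬decreasing xs ¬d
    with stripZ xs
       | (λ (l : Linked ℕ._≥_ (stripZ xs)) → ¬d (decreasing-resp-≋ {stripZ xs} {xs} (height-stripZ xs) (linked⇒decreasing l)))
  ... | ys | ¬l with linked? ℕ._≥?_ ys | all? (0 <?_) ys
  ...   | yes l | yes _ = ⊥-elim (¬l l)
  ...   | yes l | no _  = refl
  ...   | no _  | _     = refl

  addable : ℕ → List ℕ → Bool
  addable zero    xs = true
  addable (suc k) xs = height xs (suc k) <ᵇ height xs k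

  removable : ℕ → List ℕ → Bool
  removable k xs = height xs (suc k) <ᵇ height xs k

  <ᵇ≡true⇒< : ∀ {m n} → (m <ᵇ n) ≡ true → m < n
  <ᵇ≡true⇒< {m} {n} e = <ᵇ⇒< m n (subst T (sym e) tt)

  <⇒<ᵇ≡true : ∀ {m n} → m < n → (m <ᵇ n) ≡ true
  <⇒<ᵇ≡true {m} {n} m<n with m <ᵇ n | <⇒<ᵇ m<n
  ... | true | _ = refl

  addable-resp-≋ : ∀ k {xs ys} → xs ≋ ys → addable k xs ≡ addable k ys
  addable-resp-≋ zero    e = refl
  addable-resp-≋ (suc k) e = cong₂ _<ᵇ_ (e (suc k)) (e k)

  removable-resp-≋ : ∀ k {xs ys} → xs ≋ ys → removable k xs ≡ removable k ys
  removable-resp-≋ k e = cong₂ _<ᵇ_ (e (suc k)) (e k)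

  removable⇒nonempty : ∀ k xs → removable k xs ≡ true → 0 < height xs k
  removable⇒nonempty k xs r = <-≤-trans (s≤s z≤n) (<ᵇ≡true⇒< {height xs (suc k)} {height xs k} r)

  rawAdd-decreasing : ∀ k xs → Decreasing xs → addable k xs ≡ true → Decreasing (rawAdd k xs)
  rawAdd-decreasing k xs d a n with suc n ≟ k | n ≟ k
  ... | yes refl | yes e  = ⊥-elim (n≢1+n e)
  ... | yes refl | no n≢k =
    subst₂ _≤_ (sym (height-rawAdd-≡ (suc n) xs)) (sym (height-rawAdd-≢ (suc n) xs n n≢k)) (<ᵇ≡true⇒< a)
  ... | no 1+n≢k | yes refl =
    subst₂ _≤_ (sym (height-rawAdd-≢ n xs (suc n) 1+n≢k)) (sym (height-rawAdd-≡ n xs)) (m≤n⇒m≤1+n (d n))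
  ... | no 1+n≢k | no n≢k =
    subst₂ _≤_ (sym (height-rawAdd-≢ k xs (suc n) 1+n≢k)) (sym (height-rawAdd-≢ k xs n n≢k)) (d n)

  rawDec-decreasing : ∀ k xs → Decreasing xs → removable k xs ≡ true → Decreasing (rawDec k xs)
  rawDec-decreasing k xs d r n with suc n ≟ k | n ≟ k
  ... | yes refl | yes e  = ⊥-elim (n≢1+n e)
  ... | yes refl | no n≢k =
    subst₂ _≤_ (sym (height-rawDec-≡ (suc n) xs)) (sym (height-rawDec-≢ (suc n) xs n n≢k))
      (≤-trans (pred[n]≤n {height xs (suc n)}) (d n))
  ... | no 1+n≢k | yes refl =
    subst₂ _≤_ (sym (height-rawDec-≢ n xs (suc n) 1+n≢k)) (sym (height-rawDec-≡ n xs))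
      (<⇒≤pred (<ᵇ≡true⇒< {height xs (suc n)} {height xs n} r))
  ... | no 1+n≢k | no n≢k =
    subst₂ _≤_ (sym (height-rawDec-≢ k xs (suc n) 1+n≢k)) (sym (height-rawDec-≢ k xs n n≢k)) (d n)

  rawAdd-decreasing⇒addable : ∀ k xs → Decreasing (rawAdd k xs) → addable k xs ≡ true
  rawAdd-decreasing⇒addable zero    xs d = refl
  rawAdd-decreasing⇒addable (suc k) xs d =
    <⇒<ᵇ≡true (subst₂ _≤_ (height-rawAdd-≡ (suc k) xs) (height-rawAdd-≢ (suc k) xs k n≢1+n) (d k))

  rawDec-decreasing⇒removable : ∀ k xs → 0 < height xs k → Decreasing (rawDec k xs) → removable k xs ≡ true
  rawDec-decreasing⇒removable k xs p d with height xs k | height-rawDec-≡ k xs | height-rawDec-≢ k xs (suc k) 1+n≢n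
  ... | suc h | dec-k | dec-1+k = <⇒<ᵇ≡true (s≤s (subst₂ _≤_ dec-1+k dec-k (d k)))

  addable-rawDec : ∀ k xs → Decreasing xs → removable k xs ≡ true → addable k (rawDec k xs) ≡ true
  addable-rawDec zero    xs d r = refl
  addable-rawDec (suc k) xs d r with height xs (suc k) | removable⇒nonempty (suc k) xs r
                                   | height-rawDec-≡ (suc k) xs | height-rawDec-≢ (suc k) xs k n≢1+n | d k
  ... | suc h | _ | dec-1+k | dec-k | h<hₖ =
    <⇒<ᵇ≡true (subst₂ _<_ (sym dec-1+k) (sym dec-k) h<hₖ)

  removable-rawAdd-0 : ∀ xs → Decreasing xs → removable 0 (rawAdd 0 xs) ≡ true
  removable-rawAdd-0 xs d =
    <⇒<ᵇ≡true (subst₂ _<_ (sym (height-rawAdd-≢ 0 xs 1 (λ ()))) (sym (height-rawAdd-≡ 0 xs)) (s≤s (d 0)))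

  Far : ℕ → ℕ → Set
  Far k l = (k ≢ l) × (suc k ≢ l) × (k ≢ suc l)

  Far-sym : ∀ {k l} → Far k l → Far l k
  Far-sym (k≢l , 1+k≢l , k≢1+l) = k≢l ∘ sym , k≢1+l ∘ sym , 1+k≢l ∘ sym

  ∣n-1+n∣≡1 : ∀ n → ∣ n - suc n ∣ ≡ 1
  ∣n-1+n∣≡1 zero    = refl
  ∣n-1+n∣≡1 (suc n) = ∣n-1+n∣≡1 n

  ∣1+n-n∣≡1 : ∀ n → ∣ suc n - n ∣ ≡ 1
  ∣1+n-n∣≡1 zero    = refl
  ∣1+n-n∣≡1 (suc n) = ∣1+n-n∣≡1 n

  Far-∸1 : ∀ i j → 1 ≤ i → 1 ≤ j → 2 ≤ ∣ i - j ∣ → Far (i ∸ 1) (j ∸ 1)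
  Far-∸1 (suc i) (suc j) _ _ 2≤∣i-j∣ =
    (λ { refl → 2≰0 (subst (2 ≤_) (∣n-n∣≡0 i) 2≤∣i-j∣) }) ,
    (λ { refl → 2≰1 (subst (2 ≤_) (∣n-1+n∣≡1 i) 2≤∣i-j∣) }) ,
    (λ { refl → 2≰1 (subst (2 ≤_) (∣1+n-n∣≡1 j) 2≤∣i-j∣) })
    where
    2≰0 : ¬ (2 ≤ 0)
    2≰0 ()
    2≰1 : ¬ (2 ≤ 1)
    2≰1 (s≤s ())

  addable-rawAdd-far : ∀ k l xs → l ≢ k → suc l ≢ k → addable k (rawAdd l xs) ≡ addable k xs
  addable-rawAdd-far zero    l xs _   _     = refl
  addable-rawAdd-far (suc k) l xs l≢k 1+l≢k =
    cong₂ _<ᵇ_ (height-rawAdd-≢ l xs (suc k) (l≢k ∘ sym)) (height-rawAdd-≢ l xs k (1+l≢k ∘ cong suc ∘ sym))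

  removable-rawAdd-far : ∀ k l xs → l ≢ k → l ≢ suc k → removable k (rawAdd l xs) ≡ removable k xs
  removable-rawAdd-far k l xs l≢k l≢1+k =
    cong₂ _<ᵇ_ (height-rawAdd-≢ l xs (suc k) (l≢1+k ∘ sym)) (height-rawAdd-≢ l xs k (l≢k ∘ sym))

  addable-rawDec-far : ∀ k l xs → l ≢ k → suc l ≢ k → addable k (rawDec l xs) ≡ addable k xs
  addable-rawDec-far zero    l xs _   _     = refl
  addable-rawDec-far (suc k) l xs l≢k 1+l≢k =
    cong₂ _<ᵇ_ (height-rawDec-≢ l xs (suc k) (l≢k ∘ sym)) (height-rawDec-≢ l xs k (1+l≢k ∘ cong suc ∘ sym))

  removable-rawDec-far : ∀ k l xs → l ≢ k → l ≢ suc k → removable k (rawDec l xs) ≡ removable k xs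
  removable-rawDec-far k l xs l≢k l≢1+k =
    cong₂ _<ᵇ_ (height-rawDec-≢ l xs (suc k) (l≢1+k ∘ sym)) (height-rawDec-≢ l xs k (l≢k ∘ sym))

  <ᵇ-pred : ∀ x y → (suc y <ᵇ x) ≡ (y <ᵇ pred x)
  <ᵇ-pred zero    y = refl
  <ᵇ-pred (suc x) y = refl

  <ᵇ-plactic₁ : ∀ x y z → y ≤ x →
    ((y <ᵇ x) ∧ ((z <ᵇ y) ∧ (pred y <ᵇ pred x))) ≡ ((z <ᵇ y) ∧ ((pred y <ᵇ x) ∧ (pred y <ᵇ pred x)))
  <ᵇ-plactic₁ x       zero    z _ = ∧-zeroʳ (0 <ᵇ x)
  <ᵇ-plactic₁ (suc x) (suc y) z (s≤s y≤x) rewrite <⇒<ᵇ≡true (s≤s y≤x) with y <ᵇ x | z <ᵇ suc y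
  ... | true  | true  = refl
  ... | true  | false = refl
  ... | false | true  = refl
  ... | false | false = refl

  <ᵇ-plactic₂ : ∀ x y z → y ≤ x →
    ((z <ᵇ y) ∧ ((pred y <ᵇ x) ∧ (z <ᵇ pred y))) ≡ ((z <ᵇ y) ∧ ((z <ᵇ pred y) ∧ (pred (pred y) <ᵇ x)))
  <ᵇ-plactic₂ x       zero          z       _ = refl
  <ᵇ-plactic₂ x       (suc zero)    zero    _ rewrite ∧-zeroʳ (0 <ᵇ x) = refl
  <ᵇ-plactic₂ x       (suc zero)    (suc z) _ = refl
  <ᵇ-plactic₂ (suc x) (suc (suc y)) z       (s≤s y≤x)
    rewrite <⇒<ᵇ≡true {y} {x} y≤x | <⇒<ᵇ≡true {y} {suc x} (s≤s (≤-trans (n≤1+n y) y≤x))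
    with z <ᵇ suc (suc y) | z <ᵇ suc y
  ... | true  | true  = refl
  ... | true  | false = refl
  ... | false | _     = refl

  positive : ℕ → Bool
  positive zero    = false
  positive (suc _) = true

  positive∞ : Maybe ℕ → Bool
  positive∞ nothing  = true
  positive∞ (just n) = positive n

  pred∞ : Maybe ℕ → Maybe ℕ
  pred∞ nothing  = nothing
  pred∞ (just n) = just (pred n)

  <ᵇ≡positive[∸] : ∀ m n → (n <ᵇ m) ≡ positive (m ∸ n)
  <ᵇ≡positive[∸] zero    zero    = refl
  <ᵇ≡positive[∸] (suc m) zero    = refl
  <ᵇ≡positive[∸] zero    (suc n) = refl
  <ᵇ≡positive[∸] (suc m) (suc n) = <ᵇ≡positive[∸] m n

  -- Around columns k, k + 1 only the gaps h(k−1) − h(k), h(k) − h(k+1), h(k+1) − h(k+2)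
  -- matter; the first is infinite (nothing) when k = 0.
  Gaps : Set
  Gaps = Maybe ℕ × ℕ × ℕ

  module AdjacentColumns (k : ℕ) where

    leftGap : ℕ → List ℕ → Maybe ℕ
    leftGap zero     xs = nothing
    leftGap (suc k′) xs = just (height xs k′ ∸ height xs (suc k′))

    gaps : List ℕ → Gaps
    gaps xs = leftGap k xs , height xs k ∸ height xs (suc k) , height xs (suc k) ∸ height xs (suc (suc k))

    afterAdd₀ afterAdd₁ : Gaps → Gaps
    afterAdd₀ (a , b , c) = pred∞ a , suc b , c
    afterAdd₁ (a , b , c) = a , pred b , suc c

    addable₀-gaps : ∀ xs → addable k xs ≡ positive∞ (proj₁ (gaps xs))
    addable₀-gaps xs = at k refl
      where
      at : ∀ k′ → k′ ≡ k → addable k′ xs ≡ positive∞ (leftGap k′ xs)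
      at zero     _ = refl
      at (suc k′) _ = <ᵇ≡positive[∸] (height xs k′) (height xs (suc k′))

    removable₀-gaps : ∀ xs → removable k xs ≡ positive (proj₁ (proj₂ (gaps xs)))
    removable₀-gaps xs = <ᵇ≡positive[∸] (height xs k) (height xs (suc k))

    addable₁-gaps : ∀ xs → addable (suc k) xs ≡ positive (proj₁ (proj₂ (gaps xs)))
    addable₁-gaps xs = <ᵇ≡positive[∸] (height xs k) (height xs (suc k))

    removable₁-gaps : ∀ xs → removable (suc k) xs ≡ positive (proj₂ (proj₂ (gaps xs)))
    removable₁-gaps xs = <ᵇ≡positive[∸] (height xs (suc k)) (height xs (suc (suc k)))

    leftGap-rawAdd₀ : ∀ k′ xs → k′ ≡ k → leftGap k′ (rawAdd k xs) ≡ pred∞ (leftGap k′ xs)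
    leftGap-rawAdd₀ zero     xs _    = refl
    leftGap-rawAdd₀ (suc k′) xs refl rewrite height-rawAdd-≢ (suc k′) xs k′ n≢1+n | height-rawAdd-≡ (suc k′) xs =
      cong just (sym (pred[m∸n]≡m∸[1+n] (height xs k′) (height xs (suc k′))))

    leftGap-rawAdd₁ : ∀ k′ xs → k′ ≡ k → leftGap k′ (rawAdd (suc k) xs) ≡ leftGap k′ xs
    leftGap-rawAdd₁ zero     xs _    = refl
    leftGap-rawAdd₁ (suc k′) xs refl
      rewrite height-rawAdd-≢ (suc (suc k′)) xs k′ n≢2+n | height-rawAdd-≢ (suc (suc k′)) xs (suc k′) n≢1+n = refl

    gaps-rawAdd₀ : ∀ xs → Decreasing xs → gaps (rawAdd k xs) ≡ afterAdd₀ (gaps xs)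
    gaps-rawAdd₀ xs d
      rewrite leftGap-rawAdd₀ k xs refl | height-rawAdd-≡ k xs | height-rawAdd-≢ k xs (suc k) 1+n≢n
            | height-rawAdd-≢ k xs (suc (suc k)) 2+n≢n =
      cong (λ g → pred∞ (leftGap k xs) , g , height xs (suc k) ∸ height xs (suc (suc k))) (+-∸-assoc 1 (d k))

    gaps-rawAdd₁ : ∀ xs → Decreasing xs → gaps (rawAdd (suc k) xs) ≡ afterAdd₁ (gaps xs)
    gaps-rawAdd₁ xs d
      rewrite leftGap-rawAdd₁ k xs refl | height-rawAdd-≡ (suc k) xs | height-rawAdd-≢ (suc k) xs k n≢1+n
            | height-rawAdd-≢ (suc k) xs (suc (suc k)) 1+n≢n =
      cong₂ (λ g g′ → leftGap k xs , g , g′)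
            (sym (pred[m∸n]≡m∸[1+n] (height xs k) (height xs (suc k)))) (+-∸-assoc 1 (d (suc k)))

    add₀^ add₁^ : ℕ → List ℕ → List ℕ
    add₀^ zero    xs = xs
    add₀^ (suc n) xs = rawAdd k (add₀^ n xs)
    add₁^ zero    xs = xs
    add₁^ (suc n) xs = rawAdd (suc k) (add₁^ n xs)

    add₀^-rawAdd₀ : ∀ n xs → add₀^ n (rawAdd k xs) ≡ rawAdd k (add₀^ n xs)
    add₀^-rawAdd₀ zero    xs = refl
    add₀^-rawAdd₀ (suc n) xs = cong (rawAdd k) (add₀^-rawAdd₀ n xs)

    add₁^-rawAdd₀ : ∀ n xs → add₁^ n (rawAdd k xs) ≡ rawAdd k (add₁^ n xs)
    add₁^-rawAdd₀ zero    xs = refl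
    add₁^-rawAdd₀ (suc n) xs = trans (cong (rawAdd (suc k)) (add₁^-rawAdd₀ n xs)) (rawAdd-comm (suc k) k (add₁^ n xs))

    add₁^-rawAdd₁ : ∀ n xs → add₁^ n (rawAdd (suc k) xs) ≡ rawAdd (suc k) (add₁^ n xs)
    add₁^-rawAdd₁ zero    xs = refl
    add₁^-rawAdd₁ (suc n) xs = cong (rawAdd (suc k)) (add₁^-rawAdd₁ n xs)

    add^-rawAdd₀ : ∀ m n xs → add₀^ m (add₁^ n (rawAdd k xs)) ≡ add₀^ (suc m) (add₁^ n xs)
    add^-rawAdd₀ m n xs = trans (cong (add₀^ m) (add₁^-rawAdd₀ n xs)) (add₀^-rawAdd₀ m (add₁^ n xs))

    add^-rawAdd₁ : ∀ m n xs → add₀^ m (add₁^ n (rawAdd (suc k) xs)) ≡ add₀^ m (add₁^ (suc n) xs)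
    add^-rawAdd₁ m n xs = cong (add₀^ m) (add₁^-rawAdd₁ n xs)

module Operators {c ℓ} (R : CommutativeRing c ℓ) (β : CommutativeRing.Carrier R) where
  open import Level using (_⊔_)
  open import Data.Bool as Bool using (Bool; true; false; _∧_; not)
  open import Data.Empty using (⊥-elim)
  open import Data.List using (List; []; _∷_; _++_; map; concatMap; foldr; length; applyUpTo; upTo)
  import Data.List.Properties as List
  open import Data.Fin as Fin using (Fin)
  import Data.Fin.Properties as Fin
  open import Data.Maybe using (Maybe; just; nothing)
  open import Data.Nat as ℕ using (zero; pred; _∸_; _<_; z≤n; s≤s)
  open import Data.Nat.ListAction using (sum)
  open import Data.Nat.Properties using (≤-refl; n≮0; 1+n≢n)
  open import Function using (_∘_)
  open import Data.Product using (_,_; proj₁; proj₂)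
  open import Data.Product.Properties using () renaming (≡-dec to ×-≡-dec)
  open import Relation.Nullary using (¬_; yes; no)
  open import Relation.Binary.Definitions using (DecidableEquality)
  open import Relation.Binary.PropositionalEquality as ≡ using (_≡_)
  import Algebra.Properties.AbelianGroup as AbelianGroupProperties
  import Algebra.Properties.CommutativeSemigroup as CommutativeSemigroupProperties
  import Algebra.Properties.Group as GroupProperties
  import Algebra.Properties.Ring as RingProperties
  open ColumnLists
  open CommutativeRing R hiding (zero)
  open Ops R β
  open import Relation.Binary.Reasoning.Setoid setoid
  open AbelianGroupProperties +-abelianGroup using (⁻¹-∙-comm; ⁻¹-anti-homo‿-)
  open GroupProperties +-group using (ε⁻¹≈ε; ⁻¹-involutive; x∙y⁻¹≈ε⇒x≈y; x≈y⇒x∙y⁻¹≈ε)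
  open RingProperties ring using (-‿distribʳ-*; -1*x≈-x; x[y-z]≈xy-xz)
  open CommutativeSemigroupProperties +-commutativeSemigroup
    using (interchange) renaming (x∙yz≈y∙xz to x+[y+z]≈y+[x+z])
  open CommutativeSemigroupProperties *-commutativeSemigroup
    using () renaming (x∙yz≈y∙xz to x*[y*z]≈y*[x*z])

  -‿+ : ∀ x y → - (x + y) ≈ - x + - y
  -‿+ x y = sym (⁻¹-∙-comm x y)

  [p+q]-[p+r]≈q-r : ∀ p q r → (p + q) - (p + r) ≈ q - r
  [p+q]-[p+r]≈q-r p q r = begin
    (p + q) - (p + r)        ≈⟨ +-cong refl (-‿+ p r) ⟩
    (p + q) + (- p + - r)    ≈⟨ interchange p q (- p) (- r) ⟩
    (p - p) + (q - r)        ≈⟨ +-cong (-‿inverseʳ p) refl ⟩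
    0# + (q - r)             ≈⟨ +-identityˡ _ ⟩
    q - r                    ∎

  β-sub-+ : ∀ a b c d → (a + b) - β * (c + d) ≈ (a - β * c) + (b - β * d)
  β-sub-+ a b c d = begin
    (a + b) - β * (c + d)         ≈⟨ +-cong refl (-‿cong (distribˡ β c d)) ⟩
    (a + b) - (β * c + β * d)     ≈⟨ +-cong refl (-‿+ _ _) ⟩
    (a + b) + (- (β * c) + - (β * d)) ≈⟨ interchange a b _ _ ⟩
    (a - β * c) + (b - β * d)     ∎

  β-sub-* : ∀ r a b → r * a - β * (r * b) ≈ r * (a - β * b)
  β-sub-* r a b = begin
    r * a - β * (r * b) ≈⟨ +-cong refl (-‿cong (x*[y*z]≈y*[x*z] β r b)) ⟩
    r * a - r * (β * b) ≈⟨ sym (x[y-z]≈xy-xz r a (β * b)) ⟩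
    r * (a - β * b)     ∎

  ≡⇒≈ : ∀ {x y} → x ≡ y → x ≈ y
  ≡⇒≈ ≡.refl = refl

  infixr 6.5 _▹_
  _▹_ : Bool → Carrier → Carrier
  true  ▹ x = x
  false ▹ x = 0#

  ▹-cong : ∀ b {x y} → x ≈ y → b ▹ x ≈ b ▹ y
  ▹-cong true  x≈y = x≈y
  ▹-cong false x≈y = refl

  ▹-+ : ∀ b x y → b ▹ (x + y) ≈ b ▹ x + b ▹ y
  ▹-+ true  x y = refl
  ▹-+ false x y = sym (+-identityˡ 0#)

  ▹-* : ∀ b r x → b ▹ (r * x) ≈ r * (b ▹ x)
  ▹-* true  r x = refl
  ▹-* false r x = sym (zeroʳ r)

  ▹-0 : ∀ b → b ▹ 0# ≈ 0#
  ▹-0 true  = refl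
  ▹-0 false = refl

  ▹-comm : ∀ b b′ x → b ▹ b′ ▹ x ≡ b′ ▹ b ▹ x
  ▹-comm true  true  x = ≡.refl
  ▹-comm true  false x = ≡.refl
  ▹-comm false true  x = ≡.refl
  ▹-comm false false x = ≡.refl

  ▹-∧ : ∀ a b b′ x → a ▹ b ▹ b′ ▹ x ≡ (a ∧ (b ∧ b′)) ▹ x
  ▹-∧ true  true  b′ x = ≡.refl
  ▹-∧ true  false b′ x = ≡.refl
  ▹-∧ false b     b′ x = ≡.refl

  ▹-β-sub : ∀ b x y → b ▹ (x - β * y) ≈ b ▹ x - β * (b ▹ y)
  ▹-β-sub true  x y = refl
  ▹-β-sub false x y = sym (trans (+-cong refl (-‿cong (zeroʳ β))) (-‿inverseʳ 0#))

  ∑ : (ℕ → Carrier) → ℕ → Carrier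
  ∑ f zero    = 0#
  ∑ f (suc n) = f 0 + ∑ (f ∘ suc) n

  ∑-cong : ∀ f g n → (∀ m → f m ≈ g m) → ∑ f n ≈ ∑ g n
  ∑-cong f g zero    f≈g = refl
  ∑-cong f g (suc n) f≈g = +-cong (f≈g 0) (∑-cong (f ∘ suc) (g ∘ suc) n (f≈g ∘ suc))

  ∑-+ : ∀ f g n → ∑ (λ m → f m + g m) n ≈ ∑ f n + ∑ g n
  ∑-+ f g zero    = sym (+-identityˡ 0#)
  ∑-+ f g (suc n) = trans (+-cong refl (∑-+ (f ∘ suc) (g ∘ suc) n)) (interchange (f 0) (g 0) _ _)

  ∑-* : ∀ r f n → ∑ (λ m → r * f m) n ≈ r * ∑ f n
  ∑-* r f zero    = sym (zeroʳ r)
  ∑-* r f (suc n) = trans (+-cong refl (∑-* r (f ∘ suc) n)) (sym (distribˡ r (f 0) _))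

  ∑-▹ : ∀ b f n → ∑ (λ m → b ▹ f m) n ≈ b ▹ ∑ f n
  ∑-▹ b f zero    = sym (▹-0 b)
  ∑-▹ b f (suc n) = trans (+-cong refl (∑-▹ b (f ∘ suc) n)) (sym (▹-+ b (f 0) _))

  -- Functions on column lists form the dual of Mod; the operators below are the
  -- transposes of u, d, d̃, ũ (so compositions appear in reverse order).
  Fn : Set c
  Fn = List ℕ → Carrier

  infix 4 _≐_
  _≐_ : Fn → Fn → Set ℓ
  F ≐ G = ∀ xs → Decreasing xs → F xs ≈ G xs

  Respects≋ : Fn → Set ℓ
  Respects≋ F = ∀ xs ys → xs ≋ ys → F xs ≈ F ys

  U : ℕ → Fn → Fn
  U k G xs = addable k xs ▹ G (rawAdd k xs)

  D : ℕ → Fn → Fn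
  D k G xs = removable k xs ▹ G (rawDec k xs)

  D^ : ℕ → ℕ → Fn → Fn
  D^ k zero    G = G
  D^ k (suc n) G = D^ k n (D k G)

  D̃ : ℕ → Fn → Fn
  D̃ k G xs = ∑ (λ m → pow β m * D^ k (suc m) G xs) (suc (sum xs))

  Ũ : ℕ → Fn → Fn
  Ũ k G xs = U k G xs - β * D k (U k G) xs

  record Linear (X : Fn → Fn) : Set (c ⊔ ℓ) where
    field
      lin-+    : ∀ F G xs → X (λ ys → F ys + G ys) xs ≈ X F xs + X G xs
      lin-*    : ∀ r F xs → X (λ ys → r * F ys) xs ≈ r * X F xs
      lin-ext  : ∀ F G → (∀ ys → F ys ≈ G ys) → ∀ xs → X F xs ≈ X G xs
      lin-cong : ∀ F G → F ≐ G → X F ≐ X G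
  open Linear public

  lin-0 : ∀ {X} → Linear X → ∀ xs → X (λ _ → 0#) xs ≈ 0#
  lin-0 {X} L xs = trans (lin-ext L _ (λ _ → 0# * 0#) (λ _ → sym (zeroˡ 0#)) xs)
                         (trans (lin-* L 0# (λ _ → 0#) xs) (zeroˡ _))

  lin-neg : ∀ {X} → Linear X → ∀ F xs → X (λ ys → - F ys) xs ≈ - X F xs
  lin-neg {X} L F xs = begin
    X (λ ys → - F ys) xs     ≈⟨ lin-ext L _ _ (λ ys → sym (-1*x≈-x (F ys))) xs ⟩
    X (λ ys → - 1# * F ys) xs ≈⟨ lin-* L (- 1#) F xs ⟩
    - 1# * X F xs            ≈⟨ -1*x≈-x _ ⟩
    - X F xs                 ∎

  lin-sub : ∀ {X} → Linear X → ∀ F G xs → X (λ ys → F ys - G ys) xs ≈ X F xs - X G xs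
  lin-sub L F G xs = trans (lin-+ L F (λ ys → - G ys) xs) (+-cong refl (lin-neg L G xs))

  id-linear : Linear (λ F → F)
  id-linear = record
    { lin-+ = λ _ _ _ → refl ; lin-* = λ _ _ _ → refl ; lin-ext = λ _ _ F≈G → F≈G ; lin-cong = λ _ _ F≐G → F≐G }

  ∘-linear : ∀ {X Y} → Linear X → Linear Y → Linear (λ F → X (Y F))
  ∘-linear LX LY = record
    { lin-+    = λ F G xs → trans (lin-ext LX _ _ (lin-+ LY F G) xs) (lin-+ LX _ _ xs)
    ; lin-*    = λ r F xs → trans (lin-ext LX _ _ (lin-* LY r F) xs) (lin-* LX r _ xs)
    ; lin-ext  = λ F G F≈G → lin-ext LX _ _ (lin-ext LY F G F≈G)
    ; lin-cong = λ F G F≐G → lin-cong LX _ _ (lin-cong LY F G F≐G)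
    }

  β-sub-linear : ∀ {X Y} → Linear X → Linear Y → Linear (λ G xs → X G xs - β * Y G xs)
  β-sub-linear LX LY = record
    { lin-+    = λ F G xs → trans (+-cong (lin-+ LX F G xs) (-‿cong (*-cong refl (lin-+ LY F G xs))))
                                  (β-sub-+ _ _ _ _)
    ; lin-*    = λ r F xs → trans (+-cong (lin-* LX r F xs) (-‿cong (*-cong refl (lin-* LY r F xs))))
                                  (β-sub-* r _ _)
    ; lin-ext  = λ F G F≈G xs → +-cong (lin-ext LX F G F≈G xs) (-‿cong (*-cong refl (lin-ext LY F G F≈G xs)))
    ; lin-cong = λ F G F≐G xs d → +-cong (lin-cong LX F G F≐G xs d) (-‿cong (*-cong refl (lin-cong LY F G F≐G xs d)))
    }

  guarded-linear : ∀ (guard : ℕ → List ℕ → Bool) (shift : ℕ → List ℕ → List ℕ) k →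
    (∀ xs → Decreasing xs → guard k xs ≡ true → Decreasing (shift k xs)) →
    Linear (λ G xs → guard k xs ▹ G (shift k xs))
  guarded-linear guard shift k preserves = record
    { lin-+    = λ F G xs → ▹-+ (guard k xs) _ _
    ; lin-*    = λ r F xs → ▹-* (guard k xs) r _
    ; lin-ext  = λ F G F≈G xs → ▹-cong (guard k xs) (F≈G _)
    ; lin-cong = λ F G F≐G xs d → on-guard F G F≐G xs d (guard k xs) ≡.refl
    }
    where
    on-guard : ∀ F G → F ≐ G → ∀ xs → Decreasing xs → ∀ b → guard k xs ≡ b →
               b ▹ F (shift k xs) ≈ b ▹ G (shift k xs)
    on-guard F G F≐G xs d true  g = F≐G _ (preserves xs d g)
    on-guard F G F≐G xs d false g = refl

  U-linear : ∀ k → Linear (U k)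
  U-linear k = guarded-linear addable rawAdd k (rawAdd-decreasing k)

  D-linear : ∀ k → Linear (D k)
  D-linear k = guarded-linear removable rawDec k (rawDec-decreasing k)

  D^-linear : ∀ k n → Linear (D^ k n)
  D^-linear k zero    = id-linear
  D^-linear k (suc n) = ∘-linear (D^-linear k n) (D-linear k)

  D̃-linear : ∀ k → Linear (D̃ k)
  D̃-linear k = record
    { lin-+    = λ F G xs → trans (∑-cong _ (λ m → term F xs m + term G xs m) (suc (sum xs))
                                    (λ m → trans (*-cong refl (lin-+ (D^-linear k (suc m)) F G xs)) (distribˡ _ _ _)))
                                  (∑-+ (term F xs) (term G xs) (suc (sum xs)))
    ; lin-*    = λ r F xs → trans (∑-cong _ (λ m → r * term F xs m) (suc (sum xs))
                                    (λ m → trans (*-cong refl (lin-* (D^-linear k (suc m)) r F xs)) (x*[y*z]≈y*[x*z] _ r _)))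
                                  (∑-* r (term F xs) (suc (sum xs)))
    ; lin-ext  = λ F G F≈G xs → ∑-cong (term F xs) (term G xs) (suc (sum xs))
                                  (λ m → *-cong refl (lin-ext (D^-linear k (suc m)) F G F≈G xs))
    ; lin-cong = λ F G F≐G xs d → ∑-cong (term F xs) (term G xs) (suc (sum xs))
                                    (λ m → *-cong refl (lin-cong (D^-linear k (suc m)) F G F≐G xs d))
    }
    where
    term : Fn → List ℕ → ℕ → Carrier
    term F xs m = pow β m * D^ k (suc m) F xs

  Ũ-linear : ∀ k → Linear (Ũ k)
  Ũ-linear k = β-sub-linear (U-linear k) (∘-linear (D-linear k) (U-linear k))

  D^-suc : ∀ k m G xs → D^ k (suc m) G xs ≡ D k (D^ k m G) xs
  D^-suc k zero    G xs = ≡.refl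
  D^-suc k (suc m) G xs = D^-suc k m (D k G) xs

  D̃-unfold : ∀ k G xs → D̃ k G xs ≈ D k G xs + β * D k (D̃ k G) xs
  D̃-unfold k G xs = trans pull-guard (on-guard (removable k xs) ≡.refl)
    where
    ys = rawDec k xs
    series : ℕ → Carrier
    series n = ∑ (λ m → pow β m * D^ k m G ys) n
    pull-guard : D̃ k G xs ≈ removable k xs ▹ series (suc (sum xs))
    pull-guard = trans (∑-cong (λ m → pow β m * D^ k (suc m) G xs) (λ m → removable k xs ▹ (pow β m * D^ k m G ys)) (suc (sum xs))
                          (λ m → trans (*-cong refl (≡⇒≈ (D^-suc k m G xs))) (sym (▹-* (removable k xs) _ _))))
                       (∑-▹ (removable k xs) (λ m → pow β m * D^ k m G ys) (suc (sum xs)))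
    on-guard : ∀ b → removable k xs ≡ b → b ▹ series (suc (sum xs)) ≈ b ▹ G ys + β * (b ▹ D̃ k G ys)
    on-guard false _ = sym (trans (+-identityˡ _) (zeroʳ β))
    on-guard true  r rewrite ≡.sym (sum-rawDec k xs (removable⇒nonempty k xs r)) =
      +-cong (*-identityˡ _)
        (trans (∑-cong (λ m → pow β (suc m) * D^ k (suc m) G ys) (λ m → β * (pow β m * D^ k (suc m) G ys)) (suc (sum ys))
                       (λ m → *-assoc β _ _))
               (∑-* β (λ m → pow β m * D^ k (suc m) G ys) (suc (sum ys))))

  -- D lowers the number of boxes, so a function with E = β · D E vanishes on partitions.
  ≐β*D⇒≐0 : ∀ k E → (∀ xs → Decreasing xs → E xs ≈ β * D k E xs) → E ≐ (λ _ → 0#)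
  ≐β*D⇒≐0 k E E≈β*DE xs d = bounded (suc (sum xs)) xs d ≤-refl
    where
    bounded : ∀ n xs → Decreasing xs → suc (sum xs) ≤ n → E xs ≈ 0#
    bounded zero    xs d ()
    bounded (suc n) xs d (s≤s size≤n) = trans (E≈β*DE xs d) (on-guard (removable k xs) ≡.refl)
      where
      on-guard : ∀ b → removable k xs ≡ b → β * (b ▹ E (rawDec k xs)) ≈ 0#
      on-guard false _ = zeroʳ β
      on-guard true  r = trans (*-cong refl (bounded n (rawDec k xs) (rawDec-decreasing k xs d r)
                                  (≡.subst (_≤ n) (≡.sym (sum-rawDec k xs (removable⇒nonempty k xs r))) size≤n)))
                               (zeroʳ β)

  commutes-with-D⇒commutes-with-D̃ : ∀ k X → Linear X →
    (∀ H → (λ xs → X (D k H) xs) ≐ (λ xs → D k (X H) xs)) →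
    ∀ G → (λ xs → X (D̃ k G) xs) ≐ (λ xs → D̃ k (X G) xs)
  commutes-with-D⇒commutes-with-D̃ k X L XD≐DX G xs d = x∙y⁻¹≈ε⇒x≈y _ _ (≐β*D⇒≐0 k E E≈β*DE xs d)
    where
    E : Fn
    E ys = X (D̃ k G) ys - D̃ k (X G) ys
    E≈β*DE : ∀ ys → Decreasing ys → E ys ≈ β * D k E ys
    E≈β*DE ys dy = begin
      X (D̃ k G) ys - D̃ k (X G) ys
        ≈⟨ +-cong (lin-ext L _ _ (D̃-unfold k G) ys) (-‿cong (D̃-unfold k (X G) ys)) ⟩
      X (λ zs → D k G zs + β * D k (D̃ k G) zs) ys - (D k (X G) ys + β * D k (D̃ k (X G)) ys)
        ≈⟨ +-cong (trans (lin-+ L _ _ ys) (+-cong (XD≐DX G ys dy) (trans (lin-* L β _ ys) (*-cong refl (XD≐DX (D̃ k G) ys dy)))))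
                  refl ⟩
      (D k (X G) ys + β * D k (X (D̃ k G)) ys) - (D k (X G) ys + β * D k (D̃ k (X G)) ys)
        ≈⟨ [p+q]-[p+r]≈q-r _ _ _ ⟩
      β * D k (X (D̃ k G)) ys - β * D k (D̃ k (X G)) ys
        ≈⟨ sym (x[y-z]≈xy-xz β _ _) ⟩
      β * (D k (X (D̃ k G)) ys - D k (D̃ k (X G)) ys)
        ≈⟨ *-cong refl (sym (lin-sub (D-linear k) (X (D̃ k G)) (D̃ k (X G)) ys)) ⟩
      β * D k E ys ∎

  infix 4 ⟪_,_⟫
  ⟪_,_⟫ : Mod → (Partition → Carrier) → Carrier
  ⟪ []          , g ⟫ = 0#
  ⟪ (a , ν) ∷ v , g ⟫ = a * g ν + ⟪ v , g ⟫

  ⟪⟫-++ : ∀ v w g → ⟪ v ++ w , g ⟫ ≈ ⟪ v , g ⟫ + ⟪ w , g ⟫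
  ⟪⟫-++ []            w g = sym (+-identityˡ _)
  ⟪⟫-++ ((a , ν) ∷ v) w g = trans (+-cong refl (⟪⟫-++ v w g)) (sym (+-assoc _ _ _))

  ⟪⟫-scale : ∀ r v g → ⟪ scale r v , g ⟫ ≈ r * ⟪ v , g ⟫
  ⟪⟫-scale r []            g = sym (zeroʳ r)
  ⟪⟫-scale r ((a , ν) ∷ v) g = trans (+-cong (*-assoc r a _) (⟪⟫-scale r v g)) (sym (distribˡ r _ _))

  ⟪⟫-⊖ : ∀ v w g → ⟪ v ⊖ w , g ⟫ ≈ ⟪ v , g ⟫ - ⟪ w , g ⟫
  ⟪⟫-⊖ v w g = trans (⟪⟫-++ v (scale (- 1#) w) g) (+-cong refl (trans (⟪⟫-scale (- 1#) w g) (-1*x≈-x _)))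

  ⟪⟫-basis : ∀ ν g → ⟪ basis ν , g ⟫ ≈ g ν
  ⟪⟫-basis ν g = trans (+-identityʳ _) (*-identityˡ _)

  ⟪⟫-linExt : ∀ f v g → ⟪ linExt f v , g ⟫ ≈ ⟪ v , (λ ν → ⟪ f ν , g ⟫) ⟫
  ⟪⟫-linExt f []            g = refl
  ⟪⟫-linExt f ((a , ν) ∷ v) g =
    trans (⟪⟫-++ (scale a (f ν)) (linExt f v) g) (+-cong (⟪⟫-scale a (f ν) g) (⟪⟫-linExt f v g))

  ⟪⟫-linExt-basis : ∀ f ν g → ⟪ linExt f (basis ν) , g ⟫ ≈ ⟪ f ν , g ⟫
  ⟪⟫-linExt-basis f ν g = trans (⟪⟫-linExt f (basis ν) g) (⟪⟫-basis ν (λ μ → ⟪ f μ , g ⟫))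

  ⟪⟫-cong : ∀ v g h → (∀ ν → g ν ≈ h ν) → ⟪ v , g ⟫ ≈ ⟪ v , h ⟫
  ⟪⟫-cong []            g h g≈h = refl
  ⟪⟫-cong ((a , ν) ∷ v) g h g≈h = +-cong (*-cong refl (g≈h ν)) (⟪⟫-cong v g h g≈h)

  ⟪⟫-+ : ∀ v g h → ⟪ v , (λ ν → g ν + h ν) ⟫ ≈ ⟪ v , g ⟫ + ⟪ v , h ⟫
  ⟪⟫-+ []            g h = sym (+-identityˡ 0#)
  ⟪⟫-+ ((a , ν) ∷ v) g h = trans (+-cong (distribˡ a _ _) (⟪⟫-+ v g h)) (interchange _ _ _ _)

  ⟪⟫-* : ∀ v r g → ⟪ v , (λ ν → r * g ν) ⟫ ≈ r * ⟪ v , g ⟫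
  ⟪⟫-* []            r g = sym (zeroʳ r)
  ⟪⟫-* ((a , ν) ∷ v) r g = trans (+-cong (x*[y*z]≈y*[x*z] a r _) (⟪⟫-* v r g)) (sym (distribˡ r _ _))

  ⟪⟫-neg : ∀ v g → ⟪ v , (λ ν → - g ν) ⟫ ≈ - ⟪ v , g ⟫
  ⟪⟫-neg []            g = sym ε⁻¹≈ε
  ⟪⟫-neg ((a , ν) ∷ v) g = trans (+-cong (sym (-‿distribʳ-* a _)) (⟪⟫-neg v g)) (sym (-‿+ _ _))

  ⟪⟫-0 : ∀ v → ⟪ v , (λ _ → 0#) ⟫ ≈ 0#
  ⟪⟫-0 []            = refl
  ⟪⟫-0 ((a , ν) ∷ v) = trans (+-cong (zeroʳ a) (⟪⟫-0 v)) (+-identityˡ 0#)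

  cols-decreasing : ∀ ν → Decreasing (cols ν)
  cols-decreasing ν = linked⇒decreasing (decr ν)

  record Transposed (O : Op) (Oᵀ : Fn → Fn) : Set (c ⊔ ℓ) where
    field
      respects  : ∀ G → Respects≋ G → Respects≋ (Oᵀ G)
      transpose : ∀ G → Respects≋ G → ∀ v → ⟪ O v , G ∘ cols ⟫ ≈ ⟪ v , Oᵀ G ∘ cols ⟫
  open Transposed public

  transposed-linExt : ∀ f Oᵀ → (∀ G → Respects≋ G → Respects≋ (Oᵀ G)) →
    (∀ G → Respects≋ G → ∀ ν → ⟪ linExt f (basis ν) , G ∘ cols ⟫ ≈ Oᵀ G (cols ν)) → Transposed (linExt f) Oᵀ
  transposed-linExt f Oᵀ resp on-basis = record
    { respects  = resp
    ; transpose = λ G rG v → trans (⟪⟫-linExt f v (G ∘ cols))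
                               (⟪⟫-cong v _ _ (λ ν → trans (sym (⟪⟫-linExt-basis f ν (G ∘ cols))) (on-basis G rG ν)))
    }

  transposed-∘ : ∀ {A Aᵀ B Bᵀ} → Transposed A Aᵀ → Transposed B Bᵀ → Transposed (A ∘ₒ B) (λ G → Bᵀ (Aᵀ G))
  transposed-∘ {B = B} TA TB = record
    { respects  = λ G rG → respects TB _ (respects TA G rG)
    ; transpose = λ G rG v → trans (transpose TA G rG (B v)) (transpose TB _ (respects TA G rG) v)
    }

  transposed-+ : ∀ {A Aᵀ B Bᵀ} → Transposed A Aᵀ → Transposed B Bᵀ →
    Transposed (A +ₒ B) (λ G xs → Aᵀ G xs + Bᵀ G xs)
  transposed-+ {A} {B = B} TA TB = record
    { respects  = λ G rG xs ys e → +-cong (respects TA G rG xs ys e) (respects TB G rG xs ys e)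
    ; transpose = λ G rG v → trans (⟪⟫-++ (A v) (B v) (G ∘ cols))
                               (trans (+-cong (transpose TA G rG v) (transpose TB G rG v)) (sym (⟪⟫-+ v _ _)))
    }

  transposed-commutator : ∀ {A Aᵀ B Bᵀ} → Transposed A Aᵀ → Transposed B Bᵀ →
    Transposed (⟦ A , B ⟧) (λ G xs → Bᵀ (Aᵀ G) xs - Aᵀ (Bᵀ G) xs)
  transposed-commutator {A} {Aᵀ} {B} {Bᵀ} TA TB = record
    { respects  = λ G rG xs ys e → +-cong (respects TAB G rG xs ys e) (-‿cong (respects TBA G rG xs ys e))
    ; transpose = λ G rG v → begin
        ⟪ A (B v) ⊖ B (A v) , G ∘ cols ⟫
          ≈⟨ ⟪⟫-⊖ (A (B v)) (B (A v)) (G ∘ cols) ⟩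
        ⟪ A (B v) , G ∘ cols ⟫ - ⟪ B (A v) , G ∘ cols ⟫
          ≈⟨ +-cong (transpose TAB G rG v) (-‿cong (transpose TBA G rG v)) ⟩
        ⟪ v , Bᵀ (Aᵀ G) ∘ cols ⟫ - ⟪ v , Aᵀ (Bᵀ G) ∘ cols ⟫
          ≈⟨ sym (trans (⟪⟫-+ v _ _) (+-cong refl (⟪⟫-neg v _))) ⟩
        ⟪ v , (λ ν → Bᵀ (Aᵀ G) (cols ν) - Aᵀ (Bᵀ G) (cols ν)) ⟫ ∎
    }
    where
    TAB = transposed-∘ TA TB
    TBA = transposed-∘ TB TA

  U-respects : ∀ k G → Respects≋ G → Respects≋ (U k G)
  U-respects k G rG xs ys e rewrite addable-resp-≋ k {xs} {ys} e = ▹-cong (addable k ys) (rG _ _ (rawAdd-resp-≋ k {xs} {ys} e))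

  D-respects : ∀ k G → Respects≋ G → Respects≋ (D k G)
  D-respects k G rG xs ys e rewrite removable-resp-≋ k {xs} {ys} e = ▹-cong (removable k ys) (rG _ _ (rawDec-resp-≋ k {xs} {ys} e))

  D^-respects : ∀ k n G → Respects≋ G → Respects≋ (D^ k n G)
  D^-respects k zero    G rG = rG
  D^-respects k (suc n) G rG = D^-respects k n (D k G) (D-respects k G rG)

  D̃-respects : ∀ k G → Respects≋ G → Respects≋ (D̃ k G)
  D̃-respects k G rG xs ys e rewrite sum-resp-≋ xs ys e =
    ∑-cong (λ m → pow β m * D^ k (suc m) G xs) (λ m → pow β m * D^ k (suc m) G ys) (suc (sum ys))
      (λ m → *-cong refl (D^-respects k (suc m) G rG xs ys e))

  Ũ-respects : ∀ k G → Respects≋ G → Respects≋ (Ũ k G)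
  Ũ-respects k G rG xs ys e =
    +-cong (U-respects k G rG xs ys e) (-‿cong (*-cong refl (D-respects k (U k G) (U-respects k G rG) xs ys e)))

  ⟪fromMaybe-toPartition⟫ : ∀ G → Respects≋ G → ∀ xs b →
    (b ≡ true → Decreasing xs) → (Decreasing xs → b ≡ true) →
    ⟪ fromMaybe (toPartition xs) , G ∘ cols ⟫ ≈ b ▹ G xs
  ⟪fromMaybe-toPartition⟫ G rG xs true  ⇒dec _ with toPartition-decreasing xs (⇒dec ≡.refl)
  ... | μ , toP≡μ , cols≡ = begin
    ⟪ fromMaybe (toPartition xs) , G ∘ cols ⟫ ≡⟨ ≡.cong (λ m → ⟪ fromMaybe m , G ∘ cols ⟫) toP≡μ ⟩
    ⟪ basis μ , G ∘ cols ⟫                    ≈⟨ ⟪⟫-basis μ (G ∘ cols) ⟩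
    G (cols μ)                                ≡⟨ ≡.cong G cols≡ ⟩
    G (stripZ xs)                             ≈⟨ rG _ _ (height-stripZ xs) ⟩
    G xs                                      ∎
  ⟪fromMaybe-toPartition⟫ G rG xs false _ dec⇒ =
    ≡⇒≈ (≡.cong (λ m → ⟪ fromMaybe m , G ∘ cols ⟫) (toPartition-¬decreasing xs (λ d → false≢true (dec⇒ d))))
    where
    false≢true : ¬ false ≡ true
    false≢true ()

  u-transposed : ∀ i → Transposed (u i) (U (i ∸ 1))
  u-transposed i = transposed-linExt _ (U k) (U-respects k) on-basis
    where
    k = i ∸ 1
    on-basis : ∀ G → Respects≋ G → ∀ ν → ⟪ u i (basis ν) , G ∘ cols ⟫ ≈ U k G (cols ν)
    on-basis G rG ν = trans (⟪⟫-linExt-basis (fromMaybe ∘ toPartition ∘ rawAdd k ∘ cols) ν (G ∘ cols))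
      (⟪fromMaybe-toPartition⟫ G rG (rawAdd k (cols ν)) (addable k (cols ν))
        (rawAdd-decreasing k (cols ν) (cols-decreasing ν)) (rawAdd-decreasing⇒addable k (cols ν)))

  d-basis-empty : ∀ i ν → height (cols ν) (i ∸ 1) ≡ 0 → d i (basis ν) ≡ 𝟘
  d-basis-empty i ν hₖ≡0 rewrite rawSub-empty (i ∸ 1) (cols ν) hₖ≡0 = ≡.refl

  d-basis-nonempty : ∀ i ν → 0 < height (cols ν) (i ∸ 1) →
    d i (basis ν) ≡ linExt (fromMaybe ∘ toPartition ∘ rawDec (i ∸ 1) ∘ cols) (basis ν)
  d-basis-nonempty i ν 0<hₖ rewrite rawSub-nonempty (i ∸ 1) (cols ν) 0<hₖ = ≡.refl

  d-transposed : ∀ i → Transposed (d i) (D (i ∸ 1))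
  d-transposed i = transposed-linExt _ (D k) (D-respects k) on-basis
    where
    k = i ∸ 1
    on-basis : ∀ G → Respects≋ G → ∀ ν → ⟪ d i (basis ν) , G ∘ cols ⟫ ≈ D k G (cols ν)
    on-basis G rG ν = by-height (height (cols ν) k) ≡.refl
      where
      Goal = ⟪ d i (basis ν) , G ∘ cols ⟫ ≈ D k G (cols ν)
      not-removable : ∀ b → removable k (cols ν) ≡ b → height (cols ν) k ≡ 0 → b ▹ G (rawDec k (cols ν)) ≈ 0#
      not-removable false _ _   = refl
      not-removable true  r hₖ = ⊥-elim (n≮0 (≡.subst (0 <_) hₖ (removable⇒nonempty k (cols ν) r)))
      nonempty : 0 < height (cols ν) k → Goal
      nonempty 0<hₖ rewrite d-basis-nonempty i ν 0<hₖ =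
        trans (⟪⟫-linExt-basis (fromMaybe ∘ toPartition ∘ rawDec k ∘ cols) ν (G ∘ cols))
        (⟪fromMaybe-toPartition⟫ G rG (rawDec k (cols ν)) (removable k (cols ν))
          (rawDec-decreasing k (cols ν) (cols-decreasing ν)) (rawDec-decreasing⇒removable k (cols ν) 0<hₖ))
      by-height : ∀ h → height (cols ν) k ≡ h → Goal
      by-height zero    hₖ rewrite d-basis-empty i ν hₖ = sym (not-removable (removable k (cols ν)) ≡.refl hₖ)
      by-height (suc h) hₖ = nonempty (≡.subst (0 <_) (≡.sym hₖ) (s≤s z≤n))

  iter-d-transpose : ∀ i n G → Respects≋ G → ∀ w → ⟪ iter n (d i) w , G ∘ cols ⟫ ≈ ⟪ w , D^ (i ∸ 1) n G ∘ cols ⟫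
  iter-d-transpose i zero    G rG w = refl
  iter-d-transpose i (suc n) G rG w =
    trans (transpose (d-transposed i) G rG (iter n (d i) w))
          (iter-d-transpose i n (D (i ∸ 1) G) (D-respects (i ∸ 1) G rG) w)

  ⟪⟫-series : ∀ (V : ℕ → Mod) ms g →
    ⟪ foldr (λ m acc → scale (pow β m) (V m) ⊕ acc) 𝟘 ms , g ⟫ ≈ foldr (λ m acc → pow β m * ⟪ V m , g ⟫ + acc) 0# ms
  ⟪⟫-series V []       g = refl
  ⟪⟫-series V (m ∷ ms) g =
    trans (⟪⟫-++ (scale (pow β m) (V m)) _ g) (+-cong (⟪⟫-scale _ (V m) g) (⟪⟫-series V ms g))

  foldr-applyUpTo : ∀ (F : ℕ → Carrier) f n → foldr (λ m acc → F m + acc) 0# (applyUpTo f n) ≡ ∑ (F ∘ f) n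
  foldr-applyUpTo F f zero    = ≡.refl
  foldr-applyUpTo F f (suc n) = ≡.cong (F (f 0) +_) (foldr-applyUpTo F (f ∘ suc) n)

  d̃-transposed : ∀ i → Transposed (d̃ i) (D̃ (i ∸ 1))
  d̃-transposed i = transposed-linExt _ (D̃ k) (D̃-respects k) on-basis
    where
    k = i ∸ 1
    on-basis : ∀ G → Respects≋ G → ∀ ν → ⟪ d̃ i (basis ν) , G ∘ cols ⟫ ≈ D̃ k G (cols ν)
    on-basis G rG ν = begin
      ⟪ d̃ i (basis ν) , G ∘ cols ⟫
        ≈⟨ ⟪⟫-linExt-basis terms ν (G ∘ cols) ⟩
      ⟪ terms ν , G ∘ cols ⟫
        ≈⟨ ⟪⟫-series V (upTo (suc (size ν))) (G ∘ cols) ⟩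
      foldr (λ m acc → pow β m * ⟪ V m , G ∘ cols ⟫ + acc) 0# (upTo (suc (size ν)))
        ≡⟨ foldr-applyUpTo (λ m → pow β m * ⟪ V m , G ∘ cols ⟫) (λ m → m) (suc (size ν)) ⟩
      ∑ (λ m → pow β m * ⟪ V m , G ∘ cols ⟫) (suc (size ν))
        ≈⟨ ∑-cong _ (λ m → pow β m * D^ k (suc m) G (cols ν)) (suc (size ν))
             (λ m → *-cong refl (trans (iter-d-transpose i (suc m) G rG (basis ν)) (⟪⟫-basis ν (D^ k (suc m) G ∘ cols)))) ⟩
      D̃ k G (cols ν) ∎
      where
      V : ℕ → Mod
      V m = iter (suc m) (d i) (basis ν)
      terms : Partition → Mod
      terms λ′ = foldr (λ m acc → scale (pow β m) (iter (suc m) (d i) (basis λ′)) ⊕ acc) 𝟘 (upTo (suc (size λ′)))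

  ũ-transposed : ∀ i → Transposed (ũ i) (Ũ (i ∸ 1))
  ũ-transposed i = record
    { respects  = Ũ-respects k
    ; transpose = λ G rG v → begin
        ⟪ u i v ⊖ scale β (u i (d i v)) , G ∘ cols ⟫
          ≈⟨ ⟪⟫-⊖ (u i v) _ (G ∘ cols) ⟩
        ⟪ u i v , G ∘ cols ⟫ - ⟪ scale β (u i (d i v)) , G ∘ cols ⟫
          ≈⟨ +-cong (transpose (u-transposed i) G rG v)
                    (-‿cong (trans (⟪⟫-scale β (u i (d i v)) (G ∘ cols))
                                   (*-cong refl (transpose (transposed-∘ (u-transposed i) (d-transposed i)) G rG v)))) ⟩
        ⟪ v , U k G ∘ cols ⟫ - β * ⟪ v , D k (U k G) ∘ cols ⟫
          ≈⟨ sym (trans (⟪⟫-+ v (U k G ∘ cols) (λ ν → - (β * D k (U k G) (cols ν))))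
                        (+-cong refl (trans (⟪⟫-neg v (λ ν → β * D k (U k G) (cols ν))) (-‿cong (⟪⟫-* v β _))))) ⟩
        ⟪ v , Ũ k G ∘ cols ⟫ ∎
    }
    where k = i ∸ 1


  [p-q]-[s-t]≈[p-s]-[q-t] : ∀ p q s t → (p - q) - (s - t) ≈ (p - s) - (q - t)
  [p-q]-[s-t]≈[p-s]-[q-t] p q s t = begin
    (p - q) - (s - t)     ≈⟨ +-cong refl (⁻¹-anti-homo‿- s t) ⟩
    (p - q) + (t - s)     ≈⟨ interchange p (- q) t (- s) ⟩
    (p + t) + (- q - s)   ≈⟨ +-cong refl (+-comm (- q) (- s)) ⟩
    (p + t) + (- s - q)   ≈⟨ sym (interchange p (- s) t (- q)) ⟩
    (p - s) + (t - q)     ≈⟨ sym (+-cong refl (⁻¹-anti-homo‿- q t)) ⟩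
    (p - s) - (q - t)     ∎

  [a-βb]-β[c-βe]-comm : ∀ a b c e → (a - β * b) - β * (c - β * e) ≈ (a - β * c) - β * (b - β * e)
  [a-βb]-β[c-βe]-comm a b c e = begin
    (a - β * b) - β * (c - β * e)        ≈⟨ +-cong refl (-‿cong (x[y-z]≈xy-xz β c (β * e))) ⟩
    (a - β * b) - (β * c - β * (β * e))  ≈⟨ [p-q]-[s-t]≈[p-s]-[q-t] a _ _ _ ⟩
    (a - β * c) - (β * b - β * (β * e))  ≈⟨ sym (+-cong refl (-‿cong (x[y-z]≈xy-xz β b (β * e)))) ⟩
    (a - β * c) - β * (b - β * e)        ∎

  ▹-β-sub-interchange : ∀ p q r s A B C E →
    p ▹ (r ▹ A - β * (s ▹ B)) - β * (q ▹ (r ▹ C - β * (s ▹ E))) ≈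
    r ▹ (p ▹ A - β * (q ▹ C)) - β * (s ▹ (p ▹ B - β * (q ▹ E)))
  ▹-β-sub-interchange p q r s A B C E = begin
    p ▹ (r ▹ A - β * (s ▹ B)) - β * (q ▹ (r ▹ C - β * (s ▹ E)))
      ≈⟨ +-cong (▹-β-sub p _ _) (-‿cong (*-cong refl (▹-β-sub q _ _))) ⟩
    (p ▹ r ▹ A - β * (p ▹ s ▹ B)) - β * (q ▹ r ▹ C - β * (q ▹ s ▹ E))
      ≈⟨ [a-βb]-β[c-βe]-comm _ _ _ _ ⟩
    (p ▹ r ▹ A - β * (q ▹ r ▹ C)) - β * (p ▹ s ▹ B - β * (q ▹ s ▹ E))
      ≡⟨ ≡.cong₂ (λ x y → (x - β * y) - β * (p ▹ s ▹ B - β * (q ▹ s ▹ E))) (▹-comm p r A) (▹-comm q r C) ⟩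
    (r ▹ p ▹ A - β * (r ▹ q ▹ C)) - β * (p ▹ s ▹ B - β * (q ▹ s ▹ E))
      ≡⟨ ≡.cong₂ (λ x y → (r ▹ p ▹ A - β * (r ▹ q ▹ C)) - β * (x - β * y)) (▹-comm p s B) (▹-comm q s E) ⟩
    (r ▹ p ▹ A - β * (r ▹ q ▹ C)) - β * (s ▹ p ▹ B - β * (s ▹ q ▹ E))
      ≈⟨ sym (+-cong (▹-β-sub r _ _) (-‿cong (*-cong refl (▹-β-sub s _ _)))) ⟩
    r ▹ (p ▹ A - β * (q ▹ C)) - β * (s ▹ (p ▹ B - β * (q ▹ E))) ∎

  Ũ-pointwise : ℕ → Fn → Fn
  Ũ-pointwise k G xs = addable k xs ▹ G (rawAdd k xs) - β * (removable k xs ▹ G xs)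

  -- Removing a corner box and adding it back restores the partition.
  Ũ≐Ũ-pointwise : ∀ k G → Ũ k G ≐ Ũ-pointwise k G
  Ũ≐Ũ-pointwise k G xs d = +-cong refl (-‿cong (*-cong refl (on-guard (removable k xs) ≡.refl)))
    where
    on-guard : ∀ b → removable k xs ≡ b → b ▹ U k G (rawDec k xs) ≈ b ▹ G xs
    on-guard false _ = refl
    on-guard true  r rewrite addable-rawDec k xs d r | rawAdd-rawDec k xs (removable⇒nonempty k xs r) = refl

  ŨŨ-pointwise : ∀ k l G xs → Decreasing xs →
    Ũ k (Ũ l G) xs ≈ U k (Ũ-pointwise l G) xs - β * (removable k xs ▹ Ũ-pointwise l G xs)
  ŨŨ-pointwise k l G xs d = trans (Ũ≐Ũ-pointwise k (Ũ l G) xs d)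
    (+-cong (lin-cong (U-linear k) _ _ (Ũ≐Ũ-pointwise l G) xs d)
            (-‿cong (*-cong refl (▹-cong (removable k xs) (Ũ≐Ũ-pointwise l G xs d)))))

  ŨŨ-far-unfold : ∀ k l G xs → Far k l →
    U k (Ũ-pointwise l G) xs - β * (removable k xs ▹ Ũ-pointwise l G xs) ≡
    addable k xs ▹ (addable l xs ▹ G (rawAdd l (rawAdd k xs)) - β * (removable l xs ▹ G (rawAdd k xs)))
      - β * (removable k xs ▹ (addable l xs ▹ G (rawAdd l xs) - β * (removable l xs ▹ G xs)))
  ŨŨ-far-unfold k l G xs (k≢l , 1+k≢l , k≢1+l)
    rewrite addable-rawAdd-far l k xs k≢l 1+k≢l | removable-rawAdd-far l k xs k≢l k≢1+l = ≡.refl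

  ŨŨ-far-comm : ∀ k l G → Far k l → (λ xs → Ũ k (Ũ l G) xs) ≐ (λ xs → Ũ l (Ũ k G) xs)
  ŨŨ-far-comm k l G far xs d = begin
    Ũ k (Ũ l G) xs
      ≈⟨ ŨŨ-pointwise k l G xs d ⟩
    _ ≡⟨ ŨŨ-far-unfold k l G xs far ⟩
    _ ≈⟨ ▹-β-sub-interchange (addable k xs) (removable k xs) (addable l xs) (removable l xs) _ _ _ _ ⟩
    addable l xs ▹ (addable k xs ▹ G (rawAdd l (rawAdd k xs)) - β * (removable k xs ▹ G (rawAdd l xs)))
      - β * (removable l xs ▹ (addable k xs ▹ G (rawAdd k xs) - β * (removable k xs ▹ G xs)))
      ≡⟨ ≡.cong (λ ys → addable l xs ▹ (addable k xs ▹ G ys - β * (removable k xs ▹ G (rawAdd l xs)))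
                          - β * (removable l xs ▹ (addable k xs ▹ G (rawAdd k xs) - β * (removable k xs ▹ G xs))))
                (rawAdd-comm l k xs) ⟩
    _ ≡⟨ ≡.sym (ŨŨ-far-unfold l k G xs (Far-sym far)) ⟩
    _ ≈⟨ sym (ŨŨ-pointwise l k G xs d) ⟩
    Ũ l (Ũ k G) xs ∎

  DD-far-comm : ∀ k l H → Far k l → (λ xs → D k (D l H) xs) ≐ (λ xs → D l (D k H) xs)
  DD-far-comm k l H (k≢l , 1+k≢l , k≢1+l) xs d = begin
    D k (D l H) xs
      ≡⟨ ≡.cong (λ b → removable k xs ▹ b ▹ H (rawDec l (rawDec k xs))) (removable-rawDec-far l k xs k≢l k≢1+l) ⟩
    removable k xs ▹ removable l xs ▹ H (rawDec l (rawDec k xs))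
      ≡⟨ ▹-comm (removable k xs) (removable l xs) _ ⟩
    removable l xs ▹ removable k xs ▹ H (rawDec l (rawDec k xs))
      ≡⟨ ≡.cong (λ ys → removable l xs ▹ removable k xs ▹ H ys) (rawDec-comm l k xs) ⟩
    removable l xs ▹ removable k xs ▹ H (rawDec k (rawDec l xs))
      ≡⟨ ≡.cong (λ b → removable l xs ▹ b ▹ H (rawDec k (rawDec l xs)))
                (≡.sym (removable-rawDec-far k l xs (k≢l ∘ ≡.sym) (1+k≢l ∘ ≡.sym))) ⟩
    D l (D k H) xs ∎

  ŨD-far-comm : ∀ k l H → Far k l → (λ xs → Ũ k (D l H) xs) ≐ (λ xs → D l (Ũ k H) xs)
  ŨD-far-comm k l H (k≢l , 1+k≢l , k≢1+l) xs d = begin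
    Ũ k (D l H) xs
      ≈⟨ Ũ≐Ũ-pointwise k (D l H) xs d ⟩
    Ũ-pointwise k (D l H) xs
      ≡⟨ ≡.cong (λ b → addable k xs ▹ b ▹ H (rawDec l (rawAdd k xs)) - β * (removable k xs ▹ removable l xs ▹ H (rawDec l xs)))
                (removable-rawAdd-far l k xs k≢l k≢1+l) ⟩
    addable k xs ▹ removable l xs ▹ H (rawDec l (rawAdd k xs)) - β * (removable k xs ▹ removable l xs ▹ H (rawDec l xs))
      ≈⟨ sym (trans (▹-β-sub (removable l xs) _ _)
                    (≡⇒≈ (≡.cong₂ (λ x y → x - β * y) (▹-comm (removable l xs) (addable k xs) _)
                                                       (▹-comm (removable l xs) (removable k xs) _)))) ⟩
    removable l xs ▹ (addable k xs ▹ H (rawDec l (rawAdd k xs)) - β * (removable k xs ▹ H (rawDec l xs)))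
      ≡⟨ ≡.sym D-Ũ-pointwise ⟩
    D l (Ũ-pointwise k H) xs
      ≈⟨ sym (lin-cong (D-linear l) _ _ (Ũ≐Ũ-pointwise k H) xs d) ⟩
    D l (Ũ k H) xs ∎
    where
    D-Ũ-pointwise : D l (Ũ-pointwise k H) xs ≡
      removable l xs ▹ (addable k xs ▹ H (rawDec l (rawAdd k xs)) - β * (removable k xs ▹ H (rawDec l xs)))
    D-Ũ-pointwise rewrite addable-rawDec-far k l xs (k≢l ∘ ≡.sym) (k≢1+l ∘ ≡.sym)
                        | removable-rawDec-far k l xs (k≢l ∘ ≡.sym) (1+k≢l ∘ ≡.sym)
                        | rawAdd-rawDec-comm k l xs k≢l = ≡.refl

  ŨD-adjacent-comm : ∀ k H → (λ xs → Ũ (suc k) (D k H) xs) ≐ (λ xs → D k (Ũ (suc k) H) xs)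
  ŨD-adjacent-comm k H xs d = begin
    Ũ (suc k) (D k H) xs
      ≈⟨ Ũ≐Ũ-pointwise (suc k) (D k H) xs d ⟩
    removable k xs ▹ corner ▹ H ys - β * (removable (suc k) xs ▹ removable k xs ▹ H (rawDec k xs))
      ≈⟨ sym (trans (▹-β-sub (removable k xs) _ _)
                    (≡⇒≈ (≡.cong (λ x → removable k xs ▹ corner ▹ H ys - β * x)
                                 (▹-comm (removable k xs) (removable (suc k) xs) _)))) ⟩
    removable k xs ▹ (corner ▹ H ys - β * (removable (suc k) xs ▹ H (rawDec k xs)))
      ≡⟨ ≡.sym D-Ũ-pointwise ⟩
    D k (Ũ-pointwise (suc k) H) xs
      ≈⟨ sym (lin-cong (D-linear k) _ _ (Ũ≐Ũ-pointwise (suc k) H) xs d) ⟩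
    D k (Ũ (suc k) H) xs ∎
    where
    corner = removable k (rawAdd (suc k) xs)
    ys = rawDec k (rawAdd (suc k) xs)
    -- both sides say height (k + 1) + 1 < height k
    addable≡corner : addable (suc k) (rawDec k xs) ≡ corner
    addable≡corner rewrite height-rawDec-≢ k xs (suc k) 1+n≢n | height-rawDec-≡ k xs
                         | height-rawAdd-≡ (suc k) xs | height-rawAdd-≢ (suc k) xs k n≢1+n =
      ≡.sym (<ᵇ-pred (height xs k) (height xs (suc k)))
    D-Ũ-pointwise : D k (Ũ-pointwise (suc k) H) xs ≡
      removable k xs ▹ (corner ▹ H ys - β * (removable (suc k) xs ▹ H (rawDec k xs)))
    D-Ũ-pointwise rewrite addable≡corner | removable-rawDec-far (suc k) k xs n≢1+n n≢2+n
                        | rawAdd-rawDec-comm (suc k) k xs 1+n≢n = ≡.refl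

  D-plactic₁ : ∀ k H → (λ xs → D k (D (suc k) (D k H)) xs) ≐ (λ xs → D (suc k) (D k (D k H)) xs)
  D-plactic₁ k H xs d rewrite rawDec-comm (suc k) k xs | removable-rawDec-far (suc k) k xs n≢1+n n≢2+n =
    ≡⇒≈ (≡.trans (▹-∧ (removable k xs) (removable (suc k) xs) (removable k ys) (H (rawDec k ys)))
        (≡.trans (≡.cong (_▹ H (rawDec k ys)) guards)
                 (≡.sym (▹-∧ (removable (suc k) xs) (removable k (rawDec (suc k) xs)) (removable k ys) (H (rawDec k ys))))))
    where
    ys = rawDec k (rawDec (suc k) xs)
    guards : (removable k xs ∧ (removable (suc k) xs ∧ removable k ys))
           ≡ (removable (suc k) xs ∧ (removable k (rawDec (suc k) xs) ∧ removable k ys))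
    guards rewrite height-rawDec-≢ k (rawDec (suc k) xs) (suc k) 1+n≢n | height-rawDec-≡ k (rawDec (suc k) xs)
                 | height-rawDec-≡ (suc k) xs | height-rawDec-≢ (suc k) xs k n≢1+n =
      <ᵇ-plactic₁ (height xs k) (height xs (suc k)) (height xs (suc (suc k))) (d k)

  D-plactic₂ : ∀ k H → (λ xs → D (suc k) (D k (D (suc k) H)) xs) ≐ (λ xs → D (suc k) (D (suc k) (D k H)) xs)
  D-plactic₂ k H xs d rewrite rawDec-comm (suc k) k (rawDec (suc k) xs) =
    ≡⇒≈ (≡.trans (▹-∧ (removable (suc k) xs) (removable k ys) (removable (suc k) (rawDec k ys)) (H zs))
        (≡.trans (≡.cong (_▹ H zs) guards)
                 (≡.sym (▹-∧ (removable (suc k) xs) (removable (suc k) ys) (removable k (rawDec (suc k) ys)) (H zs)))))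
    where
    ys = rawDec (suc k) xs
    zs = rawDec k (rawDec (suc k) (rawDec (suc k) xs))
    guards : (removable (suc k) xs ∧ (removable k ys ∧ removable (suc k) (rawDec k ys)))
           ≡ (removable (suc k) xs ∧ (removable (suc k) ys ∧ removable k (rawDec (suc k) ys)))
    guards rewrite height-rawDec-≢ k ys (suc (suc k)) 2+n≢n | height-rawDec-≢ k ys (suc k) 1+n≢n
                 | height-rawDec-≡ (suc k) ys | height-rawDec-≢ (suc k) ys k n≢1+n
                 | height-rawDec-≢ (suc k) xs (suc (suc k)) 1+n≢n | height-rawDec-≡ (suc k) xs
                 | height-rawDec-≢ (suc k) xs k n≢1+n =
      <ᵇ-plactic₂ (height xs k) (height xs (suc k)) (height xs (suc (suc k))) (d k)

  D̃-guarded : ∀ k G xs → D̃ k G xs ≈ removable k xs ▹ D̃ k G xs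
  D̃-guarded k G xs = on-guard (removable k xs) ≡.refl
    where
    ys = rawDec k xs
    on-guard : ∀ b → removable k xs ≡ b → D̃ k G xs ≈ b ▹ D̃ k G xs
    on-guard true  _ = refl
    on-guard false r = begin
      D̃ k G xs                                                    ≈⟨ D̃-unfold k G xs ⟩
      removable k xs ▹ G ys + β * (removable k xs ▹ D̃ k G ys)     ≡⟨ ≡.cong (λ b → b ▹ G ys + β * (b ▹ D̃ k G ys)) r ⟩
      0# + β * 0#                                                 ≈⟨ trans (+-identityˡ _) (zeroʳ β) ⟩
      0#                                                          ∎

  ŨD̃-inverse : ∀ G → Respects≋ G → (λ xs → Ũ 0 (D̃ 0 G) xs) ≐ G
  ŨD̃-inverse G rG xs d = begin
    Ũ 0 F xs                                        ≈⟨ Ũ≐Ũ-pointwise 0 F xs d ⟩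
    F (rawAdd 0 xs) - β * (removable 0 xs ▹ F xs)    ≈⟨ +-cong F[xs+□] (-‿cong (*-cong refl (sym (D̃-guarded 0 G xs)))) ⟩
    (G xs + β * F xs) - β * F xs                    ≈⟨ +-assoc _ _ _ ⟩
    G xs + (β * F xs - β * F xs)                    ≈⟨ +-cong refl (-‿inverseʳ _) ⟩
    G xs + 0#                                       ≈⟨ +-identityʳ _ ⟩
    G xs                                            ∎
    where
    F = D̃ 0 G
    ys = rawDec 0 (rawAdd 0 xs)
    F[xs+□] : F (rawAdd 0 xs) ≈ G xs + β * F xs
    F[xs+□] = begin
      F (rawAdd 0 xs)                                   ≈⟨ D̃-unfold 0 G (rawAdd 0 xs) ⟩
      D 0 G (rawAdd 0 xs) + β * D 0 F (rawAdd 0 xs)     ≡⟨ ≡.cong (λ b → b ▹ G ys + β * (b ▹ F ys)) (removable-rawAdd-0 xs d) ⟩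
      G ys + β * F ys                                   ≈⟨ +-cong (rG ys xs (rawDec-rawAdd 0 xs))
                                                                  (*-cong refl (D̃-respects 0 G rG ys xs (rawDec-rawAdd 0 xs))) ⟩
      G xs + β * F xs                                   ∎


  -- Formal sums of signed monomials ±β^j·a over atoms a.  Such a sum is shown to vanish
  -- by cancelling opposite monomials pairwise, a computation that is checked by refl.
  module SignedMonomials {A : Set} (_≟ᴬ_ : DecidableEquality A) where

    Monomial : Set
    Monomial = Bool × ℕ × A

    ⟦_⟧ₘ : Monomial → (A → Carrier) → Carrier
    ⟦ true  , j , a ⟧ₘ ρ = pow β j * ρ a
    ⟦ false , j , a ⟧ₘ ρ = - (pow β j * ρ a)

    ⟦_⟧ : List Monomial → (A → Carrier) → Carrier
    ⟦ []    ⟧ ρ = 0#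
    ⟦ t ∷ l ⟧ ρ = ⟦ t ⟧ₘ ρ + ⟦ l ⟧ ρ

    ⟦⟧-cong : ∀ l ρ ρ′ → (∀ a → ρ a ≈ ρ′ a) → ⟦ l ⟧ ρ ≈ ⟦ l ⟧ ρ′
    ⟦⟧-cong []                  ρ ρ′ ρ≈ρ′ = refl
    ⟦⟧-cong ((true  , j , a) ∷ l) ρ ρ′ ρ≈ρ′ = +-cong (*-cong refl (ρ≈ρ′ a)) (⟦⟧-cong l ρ ρ′ ρ≈ρ′)
    ⟦⟧-cong ((false , j , a) ∷ l) ρ ρ′ ρ≈ρ′ = +-cong (-‿cong (*-cong refl (ρ≈ρ′ a))) (⟦⟧-cong l ρ ρ′ ρ≈ρ′)

    ⟦⟧-++ : ∀ l l′ ρ → ⟦ l ++ l′ ⟧ ρ ≈ ⟦ l ⟧ ρ + ⟦ l′ ⟧ ρ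
    ⟦⟧-++ []      l′ ρ = sym (+-identityˡ _)
    ⟦⟧-++ (t ∷ l) l′ ρ = trans (+-cong refl (⟦⟧-++ l l′ ρ)) (sym (+-assoc _ _ _))

    negateₘ : Monomial → Monomial
    negateₘ (s , j , a) = not s , j , a

    negate : List Monomial → List Monomial
    negate = map negateₘ

    ⟦negateₘ⟧ : ∀ t ρ → ⟦ negateₘ t ⟧ₘ ρ ≈ - ⟦ t ⟧ₘ ρ
    ⟦negateₘ⟧ (true  , j , a) ρ = refl
    ⟦negateₘ⟧ (false , j , a) ρ = sym (⁻¹-involutive _)

    ⟦negate⟧ : ∀ l ρ → ⟦ negate l ⟧ ρ ≈ - ⟦ l ⟧ ρ
    ⟦negate⟧ []      ρ = sym ε⁻¹≈ε
    ⟦negate⟧ (t ∷ l) ρ = trans (+-cong (⟦negateₘ⟧ t ρ) (⟦negate⟧ l ρ)) (sym (-‿+ _ _))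

    ⟦l++negate[l′]⟧ : ∀ l l′ ρ → ⟦ l ++ negate l′ ⟧ ρ ≈ ⟦ l ⟧ ρ - ⟦ l′ ⟧ ρ
    ⟦l++negate[l′]⟧ l l′ ρ = trans (⟦⟧-++ l (negate l′) ρ) (+-cong refl (⟦negate⟧ l′ ρ))

    _≟ₘ_ : DecidableEquality Monomial
    _≟ₘ_ = ×-≡-dec Bool._≟_ (×-≡-dec ℕ._≟_ _≟ᴬ_)

    removeOpposite : Monomial → List Monomial → Maybe (List Monomial)
    removeOpposite t []      = nothing
    removeOpposite t (u ∷ l) with u ≟ₘ negateₘ t
    ... | yes _ = just l
    ... | no  _ with removeOpposite t l
    ...   | just l′ = just (u ∷ l′)
    ...   | nothing = nothing

    removeOpposite-sound : ∀ t l l′ ρ → removeOpposite t l ≡ just l′ → ⟦ t ⟧ₘ ρ + ⟦ l ⟧ ρ ≈ ⟦ l′ ⟧ ρ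
    removeOpposite-sound t []      l′ ρ ()
    removeOpposite-sound t (u ∷ l) l′ ρ e with u ≟ₘ negateₘ t
    removeOpposite-sound t (u ∷ l) .l ρ ≡.refl | yes ≡.refl = begin
      ⟦ t ⟧ₘ ρ + (⟦ negateₘ t ⟧ₘ ρ + ⟦ l ⟧ ρ)   ≈⟨ sym (+-assoc _ _ _) ⟩
      (⟦ t ⟧ₘ ρ + ⟦ negateₘ t ⟧ₘ ρ) + ⟦ l ⟧ ρ   ≈⟨ +-cong (trans (+-cong refl (⟦negateₘ⟧ t ρ)) (-‿inverseʳ _)) refl ⟩
      0# + ⟦ l ⟧ ρ                             ≈⟨ +-identityˡ _ ⟩
      ⟦ l ⟧ ρ                                  ∎
    removeOpposite-sound t (u ∷ l) l′ ρ e | no _ with removeOpposite t l in removed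
    removeOpposite-sound t (u ∷ l) .(u ∷ l″) ρ ≡.refl | no _ | just l″ = begin
      ⟦ t ⟧ₘ ρ + (⟦ u ⟧ₘ ρ + ⟦ l ⟧ ρ)   ≈⟨ x+[y+z]≈y+[x+z] _ _ _ ⟩
      ⟦ u ⟧ₘ ρ + (⟦ t ⟧ₘ ρ + ⟦ l ⟧ ρ)   ≈⟨ +-cong refl (removeOpposite-sound t l l″ ρ removed) ⟩
      ⟦ u ⟧ₘ ρ + ⟦ l″ ⟧ ρ               ∎
    removeOpposite-sound t (u ∷ l) l′ ρ () | no _ | nothing

    cancel : ℕ → List Monomial → List Monomial
    cancel zero    l       = l
    cancel (suc n) []      = []
    cancel (suc n) (t ∷ l) with removeOpposite t l
    ... | just l′ = cancel n l′
    ... | nothing = t ∷ cancel n l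

    cancel-sound : ∀ n l ρ → ⟦ cancel n l ⟧ ρ ≈ ⟦ l ⟧ ρ
    cancel-sound zero    l       ρ = refl
    cancel-sound (suc n) []      ρ = refl
    cancel-sound (suc n) (t ∷ l) ρ with removeOpposite t l in removed
    ... | just l′ = trans (cancel-sound n l′ ρ) (sym (removeOpposite-sound t l l′ ρ removed))
    ... | nothing = +-cong refl (cancel-sound n l ρ)

    Cancels : List Monomial → Set
    Cancels l = cancel (length l) l ≡ []

    cancels⇒≈0 : ∀ l ρ → Cancels l → ⟦ l ⟧ ρ ≈ 0#
    cancels⇒≈0 l ρ cancels = trans (sym (cancel-sound (length l) l ρ)) (≡⇒≈ (≡.cong (λ l′ → ⟦ l′ ⟧ ρ) cancels))

    signed : Bool → Carrier → Carrier
    signed true  x = x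
    signed false x = - x

    signed-cong : ∀ s {x y} → x ≈ y → signed s x ≈ signed s y
    signed-cong true  x≈y = x≈y
    signed-cong false x≈y = -‿cong x≈y

    signed-+ : ∀ s x y → signed s (x + y) ≈ signed s x + signed s y
    signed-+ true  x y = refl
    signed-+ false x y = -‿+ x y

    signed-0 : ∀ s → signed s 0# ≈ 0#
    signed-0 true  = refl
    signed-0 false = ε⁻¹≈ε

    pow-+ : ∀ j k → pow β (j ℕ.+ k) ≈ pow β j * pow β k
    pow-+ zero    k = sym (*-identityˡ _)
    pow-+ (suc j) k = trans (*-cong refl (pow-+ j k)) (sym (*-assoc _ _ _))

    scaleₘ : Bool → ℕ → Monomial → Monomial
    scaleₘ true  j (s , k , a) = s , j ℕ.+ k , a
    scaleₘ false j (s , k , a) = not s , j ℕ.+ k , a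

    scaleMonomials : Bool → ℕ → List Monomial → List Monomial
    scaleMonomials s j = map (scaleₘ s j)

    ⟦scaleₘ⟧ : ∀ s j t ρ → ⟦ scaleₘ s j t ⟧ₘ ρ ≈ signed s (pow β j * ⟦ t ⟧ₘ ρ)
    ⟦scaleₘ⟧ true  j (true  , k , a) ρ = trans (*-cong (pow-+ j k) refl) (*-assoc _ _ _)
    ⟦scaleₘ⟧ true  j (false , k , a) ρ = trans (-‿cong (trans (*-cong (pow-+ j k) refl) (*-assoc _ _ _))) (-‿distribʳ-* _ _)
    ⟦scaleₘ⟧ false j (true  , k , a) ρ = -‿cong (trans (*-cong (pow-+ j k) refl) (*-assoc _ _ _))
    ⟦scaleₘ⟧ false j (false , k , a) ρ =
      trans (trans (*-cong (pow-+ j k) refl) (*-assoc _ _ _)) (trans (sym (⁻¹-involutive _)) (-‿cong (-‿distribʳ-* _ _)))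

    ⟦scaleMonomials⟧ : ∀ s j l ρ → ⟦ scaleMonomials s j l ⟧ ρ ≈ signed s (pow β j * ⟦ l ⟧ ρ)
    ⟦scaleMonomials⟧ s j []      ρ = sym (trans (signed-cong s (zeroʳ _)) (signed-0 s))
    ⟦scaleMonomials⟧ s j (t ∷ l) ρ =
      trans (+-cong (⟦scaleₘ⟧ s j t ρ) (⟦scaleMonomials⟧ s j l ρ))
            (trans (sym (signed-+ s _ _)) (signed-cong s (sym (distribˡ _ _ _))))


  module LocalD̃Words (k : ℕ) where

    Letter : Set
    Letter = Fin 4

    pattern d₀  = Fin.zero
    pattern d₁  = Fin.suc Fin.zero
    pattern d̃₀ = Fin.suc (Fin.suc Fin.zero)
    pattern d̃₁ = Fin.suc (Fin.suc (Fin.suc Fin.zero))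

    letter : Letter → Fn → Fn
    letter d₀  = D k
    letter d₁  = D (suc k)
    letter d̃₀ = D̃ k
    letter d̃₁ = D̃ (suc k)

    letter-linear : ∀ x → Linear (letter x)
    letter-linear d₀  = D-linear k
    letter-linear d₁  = D-linear (suc k)
    letter-linear d̃₀ = D̃-linear k
    letter-linear d̃₁ = D̃-linear (suc k)

    Word : Set
    Word = List Letter

    ⟦_⟧ʷ : Word → Fn → Fn
    ⟦ []    ⟧ʷ H = H
    ⟦ x ∷ w ⟧ʷ H = letter x (⟦ w ⟧ʷ H)

    word-linear : ∀ w → Linear ⟦ w ⟧ʷ
    word-linear []      = id-linear
    word-linear (x ∷ w) = ∘-linear (letter-linear x) (word-linear w)

    ⟦++⟧ʷ : ∀ u v H → ⟦ u ++ v ⟧ʷ H ≡ ⟦ u ⟧ʷ (⟦ v ⟧ʷ H)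
    ⟦++⟧ʷ []      v H = ≡.refl
    ⟦++⟧ʷ (x ∷ u) v H = ≡.cong (letter x) (⟦++⟧ʷ u v H)

    open SignedMonomials {Word} (List.≡-dec Fin._≟_) public

    combination : List Monomial → Fn → Fn
    combination l H xs = ⟦ l ⟧ (λ w → ⟦ w ⟧ʷ H xs)

    prefix : Word → Monomial → Monomial
    prefix u (s , j , w) = s , j , u ++ w

    suffix : Word → Monomial → Monomial
    suffix v (s , j , w) = s , j , w ++ v

    ⟦prefix⟧ : ∀ u l H xs → ⟦ u ⟧ʷ (combination l H) xs ≈ combination (map (prefix u) l) H xs
    ⟦prefix⟧ u []                H xs = lin-0 (word-linear u) xs
    ⟦prefix⟧ u ((s , j , w) ∷ l) H xs = trans (lin-+ (word-linear u) _ _ xs) (+-cong (head s) (⟦prefix⟧ u l H xs))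
      where
      u·w : ⟦ u ⟧ʷ (⟦ w ⟧ʷ H) xs ≈ ⟦ u ++ w ⟧ʷ H xs
      u·w = ≡⇒≈ (≡.cong (λ F → F xs) (≡.sym (⟦++⟧ʷ u w H)))
      head : ∀ s → ⟦ u ⟧ʷ (λ ys → ⟦ s , j , w ⟧ₘ (λ w′ → ⟦ w′ ⟧ʷ H ys)) xs ≈ ⟦ s , j , u ++ w ⟧ₘ (λ w′ → ⟦ w′ ⟧ʷ H xs)
      head true  = trans (lin-* (word-linear u) _ _ xs) (*-cong refl u·w)
      head false = trans (lin-neg (word-linear u) _ xs) (-‿cong (trans (lin-* (word-linear u) _ _ xs) (*-cong refl u·w)))

    ⟦suffix⟧ : ∀ v l H xs → combination (map (suffix v) l) H xs ≈ combination l (⟦ v ⟧ʷ H) xs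
    ⟦suffix⟧ v []                H xs = refl
    ⟦suffix⟧ v ((s , j , w) ∷ l) H xs = +-cong (head s) (⟦suffix⟧ v l H xs)
      where
      w·v : ⟦ w ++ v ⟧ʷ H xs ≈ ⟦ w ⟧ʷ (⟦ v ⟧ʷ H) xs
      w·v = ≡⇒≈ (≡.cong (λ F → F xs) (⟦++⟧ʷ w v H))
      head : ∀ s → ⟦ s , j , w ++ v ⟧ₘ (λ w′ → ⟦ w′ ⟧ʷ H xs) ≈ ⟦ s , j , w ⟧ₘ (λ w′ → ⟦ w′ ⟧ʷ (⟦ v ⟧ʷ H) xs)
      head true  = *-cong refl w·v
      head false = -‿cong (*-cong refl w·v)

    record Rule : Set (c ⊔ ℓ) where
      field
        lhs   : Word
        rhs   : List Monomial
        valid : ∀ H → ⟦ lhs ⟧ʷ H ≐ combination rhs H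
    open Rule

    -- ± β ^ power · before · (lhs − rhs) · after, which vanishes on partitions
    record Instance : Set (c ⊔ ℓ) where
      constructor inst
      field
        sign   : Bool
        power  : ℕ
        before : Word
        rule   : Rule
        after  : Word

    instanceMonomials : Instance → List Monomial
    instanceMonomials (inst s j u r v) =
      scaleMonomials s j ((true , 0 , u ++ lhs r ++ v) ∷ negate (map (prefix u) (map (suffix v) (rhs r))))

    instance≐0 : ∀ i H → combination (instanceMonomials i) H ≐ (λ _ → 0#)
    instance≐0 (inst s j u r v) H xs d =
      trans (⟦scaleMonomials⟧ s j difference ρ) (trans (signed-cong s (trans (*-cong refl difference≈0) (zeroʳ _))) (signed-0 s))
      where
      ρ = λ w → ⟦ w ⟧ʷ H xs
      difference = (true , 0 , u ++ lhs r ++ v) ∷ negate (map (prefix u) (map (suffix v) (rhs r)))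
      urv : ⟦ u ++ lhs r ++ v ⟧ʷ H xs ≈ ⟦ u ⟧ʷ (⟦ lhs r ⟧ʷ (⟦ v ⟧ʷ H)) xs
      urv = ≡⇒≈ (≡.cong (λ F → F xs) (≡.trans (⟦++⟧ʷ u (lhs r ++ v) H) (≡.cong ⟦ u ⟧ʷ (⟦++⟧ʷ (lhs r) v H))))
      rhs-image : combination (map (prefix u) (map (suffix v) (rhs r))) H xs ≈ ⟦ u ⟧ʷ (⟦ lhs r ⟧ʷ (⟦ v ⟧ʷ H)) xs
      rhs-image = begin
        combination (map (prefix u) (map (suffix v) (rhs r))) H xs ≈⟨ sym (⟦prefix⟧ u (map (suffix v) (rhs r)) H xs) ⟩
        ⟦ u ⟧ʷ (combination (map (suffix v) (rhs r)) H) xs         ≈⟨ lin-ext (word-linear u) _ _ (⟦suffix⟧ v (rhs r) H) xs ⟩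
        ⟦ u ⟧ʷ (combination (rhs r) (⟦ v ⟧ʷ H)) xs                 ≈⟨ sym (lin-cong (word-linear u) _ _ (valid r (⟦ v ⟧ʷ H)) xs d) ⟩
        ⟦ u ⟧ʷ (⟦ lhs r ⟧ʷ (⟦ v ⟧ʷ H)) xs                          ∎
      difference≈0 : ⟦ difference ⟧ ρ ≈ 0#
      difference≈0 = trans (+-cong (trans (*-identityˡ _) urv) (trans (⟦negate⟧ (map (prefix u) (map (suffix v) (rhs r))) ρ) (-‿cong rhs-image)))
                           (-‿inverseʳ _)

    instances≐0 : ∀ is H → combination (concatMap (negate ∘ instanceMonomials) is) H ≐ (λ _ → 0#)
    instances≐0 []       H xs d = refl
    instances≐0 (i ∷ is) H xs d =
      trans (⟦⟧-++ (negate (instanceMonomials i)) (concatMap (negate ∘ instanceMonomials) is) (λ w → ⟦ w ⟧ʷ H xs))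
            (trans (+-cong (trans (⟦negate⟧ (instanceMonomials i) (λ w → ⟦ w ⟧ʷ H xs)) (trans (-‿cong (instance≐0 i H xs d)) ε⁻¹≈ε))
                           (instances≐0 is H xs d))
                   (+-identityˡ 0#))

    certified≐0 : ∀ E is → Cancels (E ++ concatMap (negate ∘ instanceMonomials) is) → ∀ H → combination E H ≐ (λ _ → 0#)
    certified≐0 E is cancels H xs d = begin
      combination E H xs                         ≈⟨ sym (+-identityʳ _) ⟩
      combination E H xs + 0#                    ≈⟨ +-cong refl (sym (instances≐0 is H xs d)) ⟩
      combination E H xs + combination C H xs    ≈⟨ sym (⟦⟧-++ E C (λ w → ⟦ w ⟧ʷ H xs)) ⟩
      combination (E ++ C) H xs                  ≈⟨ cancels⇒≈0 (E ++ C) (λ w → ⟦ w ⟧ʷ H xs) cancels ⟩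
      0#                                         ∎
      where C = concatMap (negate ∘ instanceMonomials) is

    ruleFromDifference : ∀ lhs rhs → (∀ H → combination ((true , 0 , lhs) ∷ negate rhs) H ≐ (λ _ → 0#)) → Rule
    ruleFromDifference lhs rhs difference≐0 = record
      { lhs = lhs ; rhs = rhs
      ; valid = λ H xs d → x∙y⁻¹≈ε⇒x≈y _ _
          (trans (+-cong (sym (*-identityˡ _)) (sym (⟦negate⟧ rhs (λ w → ⟦ w ⟧ʷ H xs)))) (difference≐0 H xs d))
      }

    infixr 5 [1-β_]·_
    [1-β_]·_ : Letter → List Monomial → List Monomial
    [1-β x ]· l = l ++ negate (scaleMonomials true 1 (map (prefix (x ∷ [])) l))

    [1-β]·-injective : ∀ kk x → (∀ F xs → letter x F xs ≡ D kk F xs) → ∀ l →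
      (∀ H → combination ([1-β x ]· l) H ≐ (λ _ → 0#)) → ∀ H → combination l H ≐ (λ _ → 0#)
    [1-β]·-injective kk x x≡D l [1-βx]l≐0 H = ≐β*D⇒≐0 kk (combination l H) l≈β*D[l]
      where
      l≈β*D[l] : ∀ xs → Decreasing xs → combination l H xs ≈ β * D kk (combination l H) xs
      l≈β*D[l] xs d = begin
        combination l H xs                                   ≈⟨ x∙y⁻¹≈ε⇒x≈y _ _ (trans (sym (⟦l++negate[l′]⟧ l x·l ρ)) ([1-βx]l≐0 H xs d)) ⟩
        combination x·l H xs                                 ≈⟨ ⟦scaleMonomials⟧ true 1 (map (prefix (x ∷ [])) l) ρ ⟩
        pow β 1 * combination (map (prefix (x ∷ [])) l) H xs ≈⟨ *-cong (*-identityʳ β) (sym (⟦prefix⟧ (x ∷ []) l H xs)) ⟩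
        β * letter x (combination l H) xs                    ≡⟨ ≡.cong (β *_) (x≡D _ xs) ⟩
        β * D kk (combination l H) xs                        ∎
        where
        ρ = λ w → ⟦ w ⟧ʷ H xs
        x·l = scaleMonomials true 1 (map (prefix (x ∷ [])) l)

    unfold₀ : Rule
    unfold₀ = record
      { lhs = d̃₀ ∷ [] ; rhs = (true , 0 , d₀ ∷ []) ∷ (true , 1 , d₀ ∷ d̃₀ ∷ []) ∷ []
      ; valid = λ H xs _ → trans (D̃-unfold k H xs) (+-cong (sym (*-identityˡ _)) (sym (trans (+-identityʳ _) (*-cong (*-identityʳ β) refl)))) }

    unfold₁ : Rule
    unfold₁ = record
      { lhs = d̃₁ ∷ [] ; rhs = (true , 0 , d₁ ∷ []) ∷ (true , 1 , d₁ ∷ d̃₁ ∷ []) ∷ []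
      ; valid = λ H xs _ → trans (D̃-unfold (suc k) H xs) (+-cong (sym (*-identityˡ _)) (sym (trans (+-identityʳ _) (*-cong (*-identityʳ β) refl)))) }

    plactic₁ : Rule
    plactic₁ = record
      { lhs = d₀ ∷ d₁ ∷ d₀ ∷ [] ; rhs = (true , 0 , d₁ ∷ d₀ ∷ d₀ ∷ []) ∷ []
      ; valid = λ H xs d → trans (D-plactic₁ k H xs d) (sym (trans (+-identityʳ _) (*-identityˡ _))) }

    plactic₂ : Rule
    plactic₂ = record
      { lhs = d₁ ∷ d₀ ∷ d₁ ∷ [] ; rhs = (true , 0 , d₁ ∷ d₁ ∷ d₀ ∷ []) ∷ []
      ; valid = λ H xs d → trans (D-plactic₂ k H xs d) (sym (trans (+-identityʳ _) (*-identityˡ _))) }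

    plactic₁-d̃₀ : Rule
    plactic₁-d̃₀ = ruleFromDifference (d₀ ∷ d₁ ∷ d̃₀ ∷ []) ((true , 0 , d₁ ∷ d₀ ∷ d̃₀ ∷ []) ∷ [])
      (certified≐0 ((true , 0 , d₀ ∷ d₁ ∷ d̃₀ ∷ []) ∷ negate ((true , 0 , d₁ ∷ d₀ ∷ d̃₀ ∷ []) ∷ []))
        ( inst true  0 (d₀ ∷ d₁ ∷ []) unfold₀  []
        ∷ inst true  0 []             plactic₁ []
        ∷ inst true  1 []             plactic₁ (d̃₀ ∷ [])
        ∷ inst false 0 (d₁ ∷ d₀ ∷ []) unfold₀  []
        ∷ []) ≡.refl)

    d₀d̃₁-exchange : Rule
    d₀d̃₁-exchange = ruleFromDifference (d₀ ∷ d̃₁ ∷ []) rhs′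
      ([1-β]·-injective (suc k) d₁ (λ _ _ → ≡.refl) ((true , 0 , d₀ ∷ d̃₁ ∷ []) ∷ negate rhs′)
        (certified≐0 ([1-β d₁ ]· (true , 0 , d₀ ∷ d̃₁ ∷ []) ∷ negate rhs′)
          ( inst true  0 (d₀ ∷ []) unfold₁  []
          ∷ inst false 0 []        unfold₁  (d₀ ∷ [])
          ∷ inst true  1 []        plactic₂ []
          ∷ inst true  2 []        plactic₂ (d̃₁ ∷ [])
          ∷ []) ≡.refl))
      where
      rhs′ : List Monomial
      rhs′ = (true , 0 , d̃₁ ∷ d₀ ∷ []) ∷ (true , 0 , d₀ ∷ d₁ ∷ []) ∷ (false , 0 , d₁ ∷ d₀ ∷ []) ∷
             (true , 1 , d₀ ∷ d₁ ∷ d̃₁ ∷ []) ∷ (false , 1 , d₁ ∷ d₀ ∷ d̃₁ ∷ []) ∷ []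

    localRelation : List Monomial
    localRelation = (true  , 0 , d̃₁ ∷ d̃₀ ∷ d̃₀ ∷ []) ∷ (true  , 0 , d̃₁ ∷ d̃₀ ∷ d̃₁ ∷ []) ∷
                    (false , 0 , d̃₀ ∷ d̃₁ ∷ d̃₀ ∷ []) ∷ (false , 0 , d̃₁ ∷ d̃₁ ∷ d̃₀ ∷ []) ∷ []

    -- Multiplying by (1 − β d₀)(1 − β d₁) turns the relation among d̃₀, d̃₁ into one that follows
    -- from the plactic relations and the unfoldings d̃ = d + β d d̃.
    localRelation≐0 : ∀ H → combination localRelation H ≐ (λ _ → 0#)
    localRelation≐0 =
      [1-β]·-injective (suc k) d₁ (λ _ _ → ≡.refl) localRelation
        ([1-β]·-injective k d₀ (λ _ _ → ≡.refl) ([1-β d₁ ]· localRelation)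
          (certified≐0 ([1-β d₀ ]· [1-β d₁ ]· localRelation)
            ( inst true  0 []        unfold₁       (d̃₀ ∷ d̃₀ ∷ [])
            ∷ inst false 1 (d₀ ∷ []) unfold₁       (d̃₀ ∷ d̃₀ ∷ [])
            ∷ inst true  0 []        unfold₁       (d̃₀ ∷ d̃₁ ∷ [])
            ∷ inst false 1 (d₀ ∷ []) unfold₁       (d̃₀ ∷ d̃₁ ∷ [])
            ∷ inst false 0 []        unfold₁       (d̃₁ ∷ d̃₀ ∷ [])
            ∷ inst true  1 (d₀ ∷ []) unfold₁       (d̃₁ ∷ d̃₀ ∷ [])
            ∷ inst false 1 []        plactic₁-d̃₀   (d̃₀ ∷ [])
            ∷ inst true  0 (d₁ ∷ []) unfold₀       (d̃₀ ∷ [])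
            ∷ inst false 1 []        plactic₁-d̃₀   (d̃₁ ∷ [])
            ∷ inst true  0 (d₁ ∷ []) unfold₀       (d̃₁ ∷ [])
            ∷ inst false 0 []        unfold₀       (d̃₁ ∷ d̃₀ ∷ [])
            ∷ inst false 2 []        plactic₁-d̃₀   (d̃₁ ∷ d̃₀ ∷ [])
            ∷ inst true  1 (d₁ ∷ []) unfold₀       (d̃₁ ∷ d̃₀ ∷ [])
            ∷ inst true  0 (d₁ ∷ []) d₀d̃₁-exchange []
            ∷ inst true  0 []        plactic₂      []
            ∷ inst true  1 []        plactic₂      (d̃₁ ∷ [])
            ∷ inst false 0 []        d₀d̃₁-exchange (d̃₀ ∷ [])
            ∷ inst false 0 []        plactic₁-d̃₀   []
            ∷ inst true  1 (d₁ ∷ []) d₀d̃₁-exchange (d̃₀ ∷ [])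
            ∷ inst true  1 (d₁ ∷ []) d₀d̃₁-exchange (d̃₀ ∷ [])
            ∷ inst true  1 []        plactic₂      (d̃₀ ∷ [])
            ∷ inst true  1 []        plactic₂      (d̃₀ ∷ [])
            ∷ inst true  2 []        plactic₂      (d̃₁ ∷ d̃₀ ∷ [])
            ∷ inst true  2 []        plactic₂      (d̃₁ ∷ d̃₀ ∷ [])
            ∷ inst false 0 []        unfold₁       (d₀ ∷ d̃₀ ∷ [])
            ∷ inst false 0 (d₁ ∷ d̃₁ ∷ []) unfold₀  []
            ∷ []) ≡.refl))

  D̃-local : ∀ k G →
    (λ xs → D̃ k (D̃ (suc k) (D̃ k G)) xs + D̃ (suc k) (D̃ (suc k) (D̃ k G)) xs) ≐
    (λ xs → D̃ (suc k) (D̃ k (λ ys → D̃ k G ys + D̃ (suc k) G ys)) xs)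
  D̃-local k G xs d = sym (begin
    B (A (λ ys → A G ys + B G ys)) xs            ≈⟨ lin-+ (∘-linear (D̃-linear (suc k)) (D̃-linear k)) (A G) (B G) xs ⟩
    B (A (A G)) xs + B (A (B G)) xs              ≈⟨ x∙y⁻¹≈ε⇒x≈y _ _ (trans (sym (as-combination _ _ _ _)) (localRelation≐0 G xs d)) ⟩
    A (B (A G)) xs + B (B (A G)) xs              ∎)
    where
    open LocalD̃Words k
    A = D̃ k
    B = D̃ (suc k)
    as-combination : ∀ p q r s → 1# * p + (1# * q + (- (1# * r) + (- (1# * s) + 0#))) ≈ (p + q) - (r + s)
    as-combination p q r s = begin
      1# * p + (1# * q + (- (1# * r) + (- (1# * s) + 0#)))
        ≈⟨ +-cong (*-identityˡ p) (+-cong (*-identityˡ q) (+-cong (-‿cong (*-identityˡ r)) (trans (+-identityʳ _) (-‿cong (*-identityˡ s))))) ⟩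
      p + (q + (- r + - s))   ≈⟨ sym (+-assoc p q _) ⟩
      (p + q) + (- r + - s)   ≈⟨ +-cong refl (sym (-‿+ r s)) ⟩
      (p + q) - (r + s)       ∎


  -- On a column list r, any word in Ũ k and Ũ (k + 1) applied to H is a combination of the values
  -- H (r + m boxes in column k + n boxes in column k + 1) whose coefficients depend only on the
  -- gaps of r.  The local relation for ũ is thus an identity of such symbolic combinations.
  module LocalŨSymbolic (k : ℕ) where
    open AdjacentColumns k
    open SignedMonomials (×-≡-dec ℕ._≟_ ℕ._≟_) public

    guarded : Bool → List Monomial → List Monomial
    guarded true  l = l
    guarded false l = []

    shift₀ shift₁ : Monomial → Monomial
    shift₀ (s , j , (m , n)) = s , j , (suc m , n)
    shift₁ (s , j , (m , n)) = s , j , (m , suc n)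

    Symbolic : Set
    Symbolic = Gaps → List Monomial

    Ũ₀ˢ Ũ₁ˢ : Symbolic → Symbolic
    Ũ₀ˢ Φ (a , b , c) = guarded (positive∞ a) (map shift₀ (Φ (pred∞ a , suc b , c)))
                        ++ scaleMonomials false 1 (guarded (positive b) (Φ (a , b , c)))
    Ũ₁ˢ Φ (a , b , c) = guarded (positive b) (map shift₁ (Φ (a , pred b , suc c)))
                        ++ scaleMonomials false 1 (guarded (positive c) (Φ (a , b , c)))

    _+ˢ_ : Symbolic → Symbolic → Symbolic
    (Φ +ˢ Ψ) g = Φ g ++ Ψ g

    atom : Symbolic
    atom _ = (true , 0 , (0 , 0)) ∷ []

    localLHSˢ localRHSˢ : Symbolic
    localLHSˢ = Ũ₀ˢ (Ũ₀ˢ (Ũ₁ˢ atom)) +ˢ Ũ₁ˢ (Ũ₀ˢ (Ũ₁ˢ atom))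
    localRHSˢ = Ũ₀ˢ (Ũ₁ˢ (Ũ₀ˢ atom +ˢ Ũ₁ˢ atom))

    -- Gaps beyond the listed small values behave uniformly, so these cases cover all of Gaps.
    local-cancels : ∀ g → Cancels (localLHSˢ g ++ negate (localRHSˢ g))
    local-cancels (nothing             , zero                , zero   ) = ≡.refl
    local-cancels (nothing             , zero                , suc _  ) = ≡.refl
    local-cancels (nothing             , suc zero            , zero   ) = ≡.refl
    local-cancels (nothing             , suc zero            , suc _  ) = ≡.refl
    local-cancels (nothing             , suc (suc zero)      , zero   ) = ≡.refl
    local-cancels (nothing             , suc (suc zero)      , suc _  ) = ≡.refl
    local-cancels (nothing             , suc (suc (suc _))   , zero   ) = ≡.refl
    local-cancels (nothing             , suc (suc (suc _))   , suc _  ) = ≡.refl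
    local-cancels (just zero           , zero                , zero   ) = ≡.refl
    local-cancels (just zero           , zero                , suc _  ) = ≡.refl
    local-cancels (just zero           , suc zero            , zero   ) = ≡.refl
    local-cancels (just zero           , suc zero            , suc _  ) = ≡.refl
    local-cancels (just zero           , suc (suc zero)      , zero   ) = ≡.refl
    local-cancels (just zero           , suc (suc zero)      , suc _  ) = ≡.refl
    local-cancels (just zero           , suc (suc (suc _))   , zero   ) = ≡.refl
    local-cancels (just zero           , suc (suc (suc _))   , suc _  ) = ≡.refl
    local-cancels (just (suc zero)     , zero                , zero   ) = ≡.refl
    local-cancels (just (suc zero)     , zero                , suc _  ) = ≡.refl
    local-cancels (just (suc zero)     , suc zero            , zero   ) = ≡.refl
    local-cancels (just (suc zero)     , suc zero            , suc _  ) = ≡.refl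
    local-cancels (just (suc zero)     , suc (suc zero)      , zero   ) = ≡.refl
    local-cancels (just (suc zero)     , suc (suc zero)      , suc _  ) = ≡.refl
    local-cancels (just (suc zero)     , suc (suc (suc _))   , zero   ) = ≡.refl
    local-cancels (just (suc zero)     , suc (suc (suc _))   , suc _  ) = ≡.refl
    local-cancels (just (suc (suc _))  , zero                , zero   ) = ≡.refl
    local-cancels (just (suc (suc _))  , zero                , suc _  ) = ≡.refl
    local-cancels (just (suc (suc _))  , suc zero            , zero   ) = ≡.refl
    local-cancels (just (suc (suc _))  , suc zero            , suc _  ) = ≡.refl
    local-cancels (just (suc (suc _))  , suc (suc zero)      , zero   ) = ≡.refl
    local-cancels (just (suc (suc _))  , suc (suc zero)      , suc _  ) = ≡.refl
    local-cancels (just (suc (suc _))  , suc (suc (suc _))   , zero   ) = ≡.refl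
    local-cancels (just (suc (suc _))  , suc (suc (suc _))   , suc _  ) = ≡.refl

    ⟦map-shift₀⟧ : ∀ l ρ → ⟦ map shift₀ l ⟧ ρ ≈ ⟦ l ⟧ (λ (m , n) → ρ (suc m , n))
    ⟦map-shift₀⟧ []                    ρ = refl
    ⟦map-shift₀⟧ ((true  , j , _) ∷ l) ρ = +-cong refl (⟦map-shift₀⟧ l ρ)
    ⟦map-shift₀⟧ ((false , j , _) ∷ l) ρ = +-cong refl (⟦map-shift₀⟧ l ρ)

    ⟦map-shift₁⟧ : ∀ l ρ → ⟦ map shift₁ l ⟧ ρ ≈ ⟦ l ⟧ (λ (m , n) → ρ (m , suc n))
    ⟦map-shift₁⟧ []                    ρ = refl
    ⟦map-shift₁⟧ ((true  , j , _) ∷ l) ρ = +-cong refl (⟦map-shift₁⟧ l ρ)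
    ⟦map-shift₁⟧ ((false , j , _) ∷ l) ρ = +-cong refl (⟦map-shift₁⟧ l ρ)

    ⟦guarded⟧ : ∀ b l ρ → ⟦ guarded b l ⟧ ρ ≈ b ▹ ⟦ l ⟧ ρ
    ⟦guarded⟧ true  l ρ = refl
    ⟦guarded⟧ false l ρ = refl

    ⟦-β·⟧ : ∀ l ρ → ⟦ scaleMonomials false 1 l ⟧ ρ ≈ - (β * ⟦ l ⟧ ρ)
    ⟦-β·⟧ l ρ = trans (⟦scaleMonomials⟧ false 1 l ρ) (-‿cong (*-cong (*-identityʳ β) refl))

    ▹-≡ : ∀ {b b′ x y} → b ≡ b′ → (b ≡ true → x ≈ y) → b ▹ x ≈ b′ ▹ y
    ▹-≡ {true}  ≡.refl x≈y = x≈y ≡.refl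
    ▹-≡ {false} ≡.refl _   = refl

    module _ (H : Fn) where

      valuesAround : List ℕ → ℕ × ℕ → Carrier
      valuesAround r (m , n) = H (add₀^ m (add₁^ n r))

      Represents : Fn → Symbolic → Set ℓ
      Represents K Φ = ∀ r → Decreasing r → K r ≈ ⟦ Φ (gaps r) ⟧ (valuesAround r)

      atom-represents : Represents H atom
      atom-represents r d = sym (trans (+-identityʳ _) (*-identityˡ _))

      +-represents : ∀ K Φ L Ψ → Represents K Φ → Represents L Ψ → Represents (λ r → K r + L r) (Φ +ˢ Ψ)
      +-represents K Φ L Ψ K~Φ L~Ψ r d =
        trans (+-cong (K~Φ r d) (L~Ψ r d)) (sym (⟦⟧-++ (Φ (gaps r)) (Ψ (gaps r)) (valuesAround r)))

      Ũ₀-represents : ∀ K Φ → Represents K Φ → Represents (Ũ k K) (Ũ₀ˢ Φ)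
      Ũ₀-represents K Φ K~Φ r d = begin
        Ũ k K r
          ≈⟨ Ũ≐Ũ-pointwise k K r d ⟩
        addable k r ▹ K (rawAdd k r) - β * (removable k r ▹ K r)
          ≈⟨ +-cong added (-‿cong (*-cong refl (▹-≡ (removable₀-gaps r) (λ _ → K~Φ r d)))) ⟩
        positive∞ a ▹ ⟦ Φ (afterAdd₀ g) ⟧ ρ′ - β * (positive b ▹ ⟦ Φ g ⟧ ρ)
          ≈⟨ sym (+-cong (trans (⟦guarded⟧ (positive∞ a) _ ρ) (▹-cong (positive∞ a) (⟦map-shift₀⟧ (Φ (afterAdd₀ g)) ρ)))
                         (trans (⟦-β·⟧ (guarded (positive b) (Φ g)) ρ) (-‿cong (*-cong refl (⟦guarded⟧ (positive b) (Φ g) ρ))))) ⟩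
        ⟦ guarded (positive∞ a) (map shift₀ (Φ (afterAdd₀ g))) ⟧ ρ + ⟦ scaleMonomials false 1 (guarded (positive b) (Φ g)) ⟧ ρ
          ≈⟨ sym (⟦⟧-++ (guarded (positive∞ a) (map shift₀ (Φ (afterAdd₀ g)))) _ ρ) ⟩
        ⟦ Ũ₀ˢ Φ (gaps r) ⟧ ρ ∎
        where
        g = gaps r
        a = proj₁ g
        b = proj₁ (proj₂ g)
        ρ = valuesAround r
        ρ′ = λ ((m , n) : ℕ × ℕ) → ρ (suc m , n)
        added : addable k r ▹ K (rawAdd k r) ≈ positive∞ a ▹ ⟦ Φ (afterAdd₀ g) ⟧ ρ′
        added = ▹-≡ (addable₀-gaps r) λ addable≡true → begin
          K (rawAdd k r)                                         ≈⟨ K~Φ (rawAdd k r) (rawAdd-decreasing k r d addable≡true) ⟩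
          ⟦ Φ (gaps (rawAdd k r)) ⟧ (valuesAround (rawAdd k r))  ≡⟨ ≡.cong (λ g′ → ⟦ Φ g′ ⟧ (valuesAround (rawAdd k r))) (gaps-rawAdd₀ r d) ⟩
          ⟦ Φ (afterAdd₀ g) ⟧ (valuesAround (rawAdd k r))        ≈⟨ ⟦⟧-cong (Φ (afterAdd₀ g)) _ ρ′ (λ (m , n) → ≡⇒≈ (≡.cong H (add^-rawAdd₀ m n r))) ⟩
          ⟦ Φ (afterAdd₀ g) ⟧ ρ′                                 ∎

      Ũ₁-represents : ∀ K Φ → Represents K Φ → Represents (Ũ (suc k) K) (Ũ₁ˢ Φ)
      Ũ₁-represents K Φ K~Φ r d = begin
        Ũ (suc k) K r
          ≈⟨ Ũ≐Ũ-pointwise (suc k) K r d ⟩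
        addable (suc k) r ▹ K (rawAdd (suc k) r) - β * (removable (suc k) r ▹ K r)
          ≈⟨ +-cong added (-‿cong (*-cong refl (▹-≡ (removable₁-gaps r) (λ _ → K~Φ r d)))) ⟩
        positive b ▹ ⟦ Φ (afterAdd₁ g) ⟧ ρ′ - β * (positive c′ ▹ ⟦ Φ g ⟧ ρ)
          ≈⟨ sym (+-cong (trans (⟦guarded⟧ (positive b) _ ρ) (▹-cong (positive b) (⟦map-shift₁⟧ (Φ (afterAdd₁ g)) ρ)))
                         (trans (⟦-β·⟧ (guarded (positive c′) (Φ g)) ρ) (-‿cong (*-cong refl (⟦guarded⟧ (positive c′) (Φ g) ρ))))) ⟩
        ⟦ guarded (positive b) (map shift₁ (Φ (afterAdd₁ g))) ⟧ ρ + ⟦ scaleMonomials false 1 (guarded (positive c′) (Φ g)) ⟧ ρ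
          ≈⟨ sym (⟦⟧-++ (guarded (positive b) (map shift₁ (Φ (afterAdd₁ g)))) _ ρ) ⟩
        ⟦ Ũ₁ˢ Φ (gaps r) ⟧ ρ ∎
        where
        g = gaps r
        b = proj₁ (proj₂ g)
        c′ = proj₂ (proj₂ g)
        ρ = valuesAround r
        ρ′ = λ ((m , n) : ℕ × ℕ) → ρ (m , suc n)
        added : addable (suc k) r ▹ K (rawAdd (suc k) r) ≈ positive b ▹ ⟦ Φ (afterAdd₁ g) ⟧ ρ′
        added = ▹-≡ (addable₁-gaps r) λ addable≡true → begin
          K (rawAdd (suc k) r)
            ≈⟨ K~Φ (rawAdd (suc k) r) (rawAdd-decreasing (suc k) r d addable≡true) ⟩
          ⟦ Φ (gaps (rawAdd (suc k) r)) ⟧ (valuesAround (rawAdd (suc k) r))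
            ≡⟨ ≡.cong (λ g′ → ⟦ Φ g′ ⟧ (valuesAround (rawAdd (suc k) r))) (gaps-rawAdd₁ r d) ⟩
          ⟦ Φ (afterAdd₁ g) ⟧ (valuesAround (rawAdd (suc k) r))
            ≈⟨ ⟦⟧-cong (Φ (afterAdd₁ g)) _ ρ′ (λ (m , n) → ≡⇒≈ (≡.cong H (add^-rawAdd₁ m n r))) ⟩
          ⟦ Φ (afterAdd₁ g) ⟧ ρ′ ∎

  Ũ-local : ∀ k G →
    (λ xs → Ũ k (Ũ k (Ũ (suc k) G)) xs + Ũ (suc k) (Ũ k (Ũ (suc k) G)) xs) ≐
    (λ xs → Ũ k (Ũ (suc k) (λ ys → Ũ k G ys + Ũ (suc k) G ys)) xs)
  Ũ-local k G r d = x∙y⁻¹≈ε⇒x≈y _ _ (begin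
    lhs - rhs                          ≈⟨ +-cong (lhs~ r d) (-‿cong (rhs~ r d)) ⟩
    ⟦ localLHSˢ g ⟧ ρ - ⟦ localRHSˢ g ⟧ ρ ≈⟨ sym (⟦l++negate[l′]⟧ (localLHSˢ g) (localRHSˢ g) ρ) ⟩
    ⟦ localLHSˢ g ++ negate (localRHSˢ g) ⟧ ρ ≈⟨ cancels⇒≈0 (localLHSˢ g ++ negate (localRHSˢ g)) ρ (local-cancels g) ⟩
    0#                                 ∎)
    where
    open AdjacentColumns k
    open LocalŨSymbolic k
    g = gaps r
    ρ = valuesAround G r
    lhs = Ũ k (Ũ k (Ũ (suc k) G)) r + Ũ (suc k) (Ũ k (Ũ (suc k) G)) r
    rhs = Ũ k (Ũ (suc k) (λ ys → Ũ k G ys + Ũ (suc k) G ys)) r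
    Ũ₁G~ : Represents G (Ũ (suc k) G) (Ũ₁ˢ atom)
    Ũ₁G~ = Ũ₁-represents G G atom (atom-represents G)
    Ũ₀Ũ₁G~ : Represents G (Ũ k (Ũ (suc k) G)) (Ũ₀ˢ (Ũ₁ˢ atom))
    Ũ₀Ũ₁G~ = Ũ₀-represents G _ (Ũ₁ˢ atom) Ũ₁G~
    lhs~ : Represents G (λ xs → Ũ k (Ũ k (Ũ (suc k) G)) xs + Ũ (suc k) (Ũ k (Ũ (suc k) G)) xs) localLHSˢ
    lhs~ = +-represents G _ (Ũ₀ˢ (Ũ₀ˢ (Ũ₁ˢ atom))) _ (Ũ₁ˢ (Ũ₀ˢ (Ũ₁ˢ atom))) (Ũ₀-represents G _ (Ũ₀ˢ (Ũ₁ˢ atom)) Ũ₀Ũ₁G~) (Ũ₁-represents G _ (Ũ₀ˢ (Ũ₁ˢ atom)) Ũ₀Ũ₁G~)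
    sum~ : Represents G (λ ys → Ũ k G ys + Ũ (suc k) G ys) (Ũ₀ˢ atom +ˢ Ũ₁ˢ atom)
    sum~ = +-represents G _ (Ũ₀ˢ atom) _ (Ũ₁ˢ atom) (Ũ₀-represents G G atom (atom-represents G)) (Ũ₁-represents G G atom (atom-represents G))
    rhs~ : Represents G (Ũ k (Ũ (suc k) (λ ys → Ũ k G ys + Ũ (suc k) G ys))) localRHSˢ
    rhs~ = Ũ₀-represents G _ (Ũ₁ˢ (Ũ₀ˢ atom +ˢ Ũ₁ˢ atom)) (Ũ₁-represents G _ (Ũ₀ˢ atom +ˢ Ũ₁ˢ atom) sum~)


  D̃D̃-far-comm : ∀ k l → Far k l → ∀ G → (λ xs → D̃ l (D̃ k G) xs) ≐ (λ xs → D̃ k (D̃ l G) xs)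
  D̃D̃-far-comm k l far =
    commutes-with-D⇒commutes-with-D̃ k (D̃ l) (D̃-linear l) (λ H xs d → sym (DD̃-far-comm H xs d))
    where
    DD̃-far-comm : ∀ G → (λ xs → D k (D̃ l G) xs) ≐ (λ xs → D̃ l (D k G) xs)
    DD̃-far-comm = commutes-with-D⇒commutes-with-D̃ l (D k) (D-linear k) (λ H → DD-far-comm k l H far)

  D̃Ũ-far-comm : ∀ k l → Far k l → ∀ G → (λ xs → D̃ l (Ũ k G) xs) ≐ (λ xs → Ũ k (D̃ l G) xs)
  D̃Ũ-far-comm k l far G xs d =
    sym (commutes-with-D⇒commutes-with-D̃ l (Ũ k) (Ũ-linear k) (λ H → ŨD-far-comm k l H far) G xs d)

  D̃Ũ-adjacent-comm : ∀ k G → (λ xs → D̃ k (Ũ (suc k) G) xs) ≐ (λ xs → Ũ (suc k) (D̃ k G) xs)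
  D̃Ũ-adjacent-comm k G xs d =
    sym (commutes-with-D⇒commutes-with-D̃ k (Ũ (suc k)) (Ũ-linear (suc k)) (ŨD-adjacent-comm k) G xs d)

  δ-cols : Partition → List ℕ → Carrier
  δ-cols μ zs with List.≡-dec ℕ._≟_ zs (cols μ)
  ... | yes _ = 1#
  ... | no  _ = 0#

  δ : Partition → Fn
  δ μ xs = δ-cols μ (stripZ xs)

  δ-respects : ∀ μ → Respects≋ (δ μ)
  δ-respects μ xs ys e = ≡⇒≈ (≡.cong (δ-cols μ) (stripZ-resp-≋ xs ys e))

  coeff≈⟪δ⟫ : ∀ μ w → coeff μ w ≈ ⟪ w , δ μ ∘ cols ⟫
  coeff≈⟪δ⟫ μ []            = refl
  coeff≈⟪δ⟫ μ ((a , ν) ∷ w) rewrite stripZ-positive (cols ν) (pos ν) with List.≡-dec ℕ._≟_ (cols ν) (cols μ)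
  ... | yes _ = +-cong (sym (*-identityʳ a)) (coeff≈⟪δ⟫ μ w)
  ... | no  _ = trans (coeff≈⟪δ⟫ μ w) (sym (trans (+-cong (zeroʳ a) refl) (+-identityˡ _)))

  transposed-≐⇒≃ : ∀ {O Oᵀ P Pᵀ} → Transposed O Oᵀ → Transposed P Pᵀ →
    (∀ G → Respects≋ G → Oᵀ G ≐ Pᵀ G) → ∀ v → O v ≃ P v
  transposed-≐⇒≃ {O} {Oᵀ} {P} {Pᵀ} TO TP Oᵀ≐Pᵀ v μ = begin
    coeff μ (O v)                 ≈⟨ coeff≈⟪δ⟫ μ (O v) ⟩
    ⟪ O v , δ μ ∘ cols ⟫          ≈⟨ transpose TO (δ μ) (δ-respects μ) v ⟩
    ⟪ v , Oᵀ (δ μ) ∘ cols ⟫       ≈⟨ ⟪⟫-cong v _ _ (λ ν → Oᵀ≐Pᵀ (δ μ) (δ-respects μ) (cols ν) (cols-decreasing ν)) ⟩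
    ⟪ v , Pᵀ (δ μ) ∘ cols ⟫       ≈⟨ sym (transpose TP (δ μ) (δ-respects μ) v) ⟩
    ⟪ P v , δ μ ∘ cols ⟫          ≈⟨ sym (coeff≈⟪δ⟫ μ (P v)) ⟩
    coeff μ (P v)                 ∎

  zero-transposed : Transposed (λ _ → 𝟘) (λ _ _ → 0#)
  zero-transposed = record { respects = λ _ _ _ _ _ → refl ; transpose = λ _ _ v → sym (⟪⟫-0 v) }

  id-transposed : Transposed (λ v → v) (λ G → G)
  id-transposed = record { respects = λ _ rG → rG ; transpose = λ _ _ _ → refl }

  commutator-≃𝟘 : ∀ {A Aᵀ B Bᵀ} → Transposed A Aᵀ → Transposed B Bᵀ →
    (∀ G → Respects≋ G → (λ xs → Bᵀ (Aᵀ G) xs) ≐ (λ xs → Aᵀ (Bᵀ G) xs)) → ∀ v → ⟦ A , B ⟧ v ≃ 𝟘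
  commutator-≃𝟘 TA TB BᵀAᵀ≐AᵀBᵀ = transposed-≐⇒≃ (transposed-commutator TA TB) zero-transposed
    (λ G rG xs d → x≈y⇒x∙y⁻¹≈ε (BᵀAᵀ≐AᵀBᵀ G rG xs d))

  ũ-nonlocal : ∀ i j → 1 ≤ i → 1 ≤ j → 2 ≤ ∣ i - j ∣ → ∀ v → ⟦ ũ i , ũ j ⟧ v ≃ 𝟘
  ũ-nonlocal i j 1≤i 1≤j 2≤∣i-j∣ = commutator-≃𝟘 (ũ-transposed i) (ũ-transposed j)
    (λ G _ → ŨŨ-far-comm (j ∸ 1) (i ∸ 1) G (Far-sym (Far-∸1 i j 1≤i 1≤j 2≤∣i-j∣)))

  d̃-nonlocal : ∀ i j → 1 ≤ i → 1 ≤ j → 2 ≤ ∣ i - j ∣ → ∀ v → ⟦ d̃ i , d̃ j ⟧ v ≃ 𝟘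
  d̃-nonlocal i j 1≤i 1≤j 2≤∣i-j∣ = commutator-≃𝟘 (d̃-transposed i) (d̃-transposed j)
    (λ G _ → D̃D̃-far-comm (i ∸ 1) (j ∸ 1) (Far-∸1 i j 1≤i 1≤j 2≤∣i-j∣) G)

  ũ-local : ∀ i → 1 ≤ i → ∀ v → ⟦ ũ (suc i) ∘ₒ ũ i , ũ i +ₒ ũ (suc i) ⟧ v ≃ 𝟘
  ũ-local (suc i) _ = commutator-≃𝟘 (transposed-∘ (ũ-transposed (suc (suc i))) (ũ-transposed (suc i)))
                                    (transposed-+ (ũ-transposed (suc i)) (ũ-transposed (suc (suc i))))
                                    (λ G _ → Ũ-local i G)

  d̃-local : ∀ i → 1 ≤ i → ∀ v → ⟦ d̃ i ∘ₒ d̃ (suc i) , d̃ i +ₒ d̃ (suc i) ⟧ v ≃ 𝟘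
  d̃-local (suc i) _ = commutator-≃𝟘 (transposed-∘ (d̃-transposed (suc i)) (d̃-transposed (suc (suc i))))
                                    (transposed-+ (d̃-transposed (suc i)) (d̃-transposed (suc (suc i))))
                                    (λ G _ → D̃-local i G)

  ũd̃-nonlocal : ∀ i j → 1 ≤ i → 1 ≤ j → 2 ≤ ∣ i - j ∣ → ∀ v → ⟦ ũ i , d̃ j ⟧ v ≃ 𝟘
  ũd̃-nonlocal i j 1≤i 1≤j 2≤∣i-j∣ = commutator-≃𝟘 (ũ-transposed i) (d̃-transposed j)
    (λ G _ → D̃Ũ-far-comm (i ∸ 1) (j ∸ 1) (Far-∸1 i j 1≤i 1≤j 2≤∣i-j∣) G)

  ũ[i+1]d̃[i]-comm : ∀ i → 1 ≤ i → ∀ v → ⟦ ũ (suc i) , d̃ i ⟧ v ≃ 𝟘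
  ũ[i+1]d̃[i]-comm (suc i) _ = commutator-≃𝟘 (ũ-transposed (suc (suc i))) (d̃-transposed (suc i)) (λ G _ → D̃Ũ-adjacent-comm i G)

  d̃₁ũ₁≃id : ∀ v → d̃ 1 (ũ 1 v) ≃ v
  d̃₁ũ₁≃id = transposed-≐⇒≃ (transposed-∘ (d̃-transposed 1) (ũ-transposed 1)) id-transposed ŨD̃-inverse

lemma3p4 : {c ℓ : Level} (R : CommutativeRing c ℓ) (β : CommutativeRing.Carrier R) →
    let open Ops R β in
    -- non-local relations
    ((i j : ℕ) → 1 ≤ i → 1 ≤ j → 2 ≤ ∣ i - j ∣ → (v : Mod) →
       (⟦ ũ i , ũ j ⟧ v ≃ 𝟘) × (⟦ d̃ i , d̃ j ⟧ v ≃ 𝟘))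
    -- local relations
    × ((i : ℕ) → 1 ≤ i → (v : Mod) →
       (⟦ ũ (suc i) ∘ₒ ũ i , ũ i +ₒ ũ (suc i) ⟧ v ≃ 𝟘)
       × (⟦ d̃ i ∘ₒ d̃ (suc i) , d̃ i +ₒ d̃ (suc i) ⟧ v ≃ 𝟘))
    -- conjugate relations
    × ((i j : ℕ) → 1 ≤ i → 1 ≤ j → 2 ≤ ∣ i - j ∣ → (v : Mod) → ⟦ ũ i , d̃ j ⟧ v ≃ 𝟘)
    × ((i : ℕ) → 1 ≤ i → (v : Mod) → ⟦ ũ (suc i) , d̃ i ⟧ v ≃ 𝟘)
    × ((v : Mod) → d̃ 1 (ũ 1 v) ≃ v)
lemma3p4 R β =
  (λ i j 1≤i 1≤j 2≤∣i-j∣ v → ũ-nonlocal i j 1≤i 1≤j 2≤∣i-j∣ v , d̃-nonlocal i j 1≤i 1≤j 2≤∣i-j∣ v) ,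
  (λ i 1≤i v → ũ-local i 1≤i v , d̃-local i 1≤i v) ,
  ũd̃-nonlocal ,
  ũ[i+1]d̃[i]-comm ,
  d̃₁ũ₁≃id
  where open Operators R β
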